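{- Let $g\ge3$, $2\le k<g$ and $m\ge2$ be integers. Suppose that there are exactly $m-1$ distinct integers $r$ such that $$a=r\,\frac{kg-1}{k^2-1}<g\quad\text{and}\quad b=r\,\frac{g-k}{k^2-1}$$ are positive integers, and suppose that the $(g,k)$ Young graph is the complete graph $K_m$. Let $r_0$ be the smallest of these $m-1$ values of $r$. Then: (i) The non-starting nodes of the Young graph are $[ir_0,ir_0]$, $0\le i\le m-1$, and the edge from the starting node (for $1\le i\le m-1$), and from the node $[0,0]$, to $[ir_0,ir_0]$ has label $\bigl(ir_0(g-k)/(k^2-1),\ ir_0(kg-1)/(k^2-1)\bigr)$. (ii) The generating function of the $(g,k)$-reverse multiples is $$\mathcal C(x)=\frac{(m-1)x^2(1+x)}{1-mx^2}=(m-1)\bigl(x^2+x^3+mx^4+mx^5+m^2x^6+m^2x^7+\cdots\bigr).$$ (iii) The $(g,k)$-reverse multiples are exactly the numbers $\gamma\beta$, where $\gamma=\bigl(r_0(g-k)/(k^2-1),\ r_0(kg-1)/(k^2-1)\bigr)_g$ (a two-digit base-$g$ number) and $\beta$ ranges over all positive integers whose base-$g$ expansion is palindromic and uses only the digits $0,1,\dots,m-1$.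
   Context: Notation: $(a_{n-1},\dots,a_1,a_0)_g$ denotes $\sum_{i=0}^{n-1}a_ig^i$ with digits $0\le a_i<g$; if $a_{n-1}\ne0$ it has length $n$. A positive integer $N=(a_{n-1},\dots,a_0)_g$ with $a_{n-1}\neq 0$ is a $(g,k)$-reverse multiple if $kN=(a_0,a_1,\dots,a_{n-1})_g$. Let $c_t$ be the number of $(g,k)$-reverse multiples of length $t$ and $\mathcal C(x)=\sum_{t\ge0}c_tx^t$. Young graph. The directed edge-labelled graph $H(g,k)$ is defined as follows. Its possible nodes are a distinguished starting node, written $[[0,0]]$, and ordered pairs $[s,r]$ of integers with $0\le s,r\le k-1$ (the pair $[0,0]$ is a node distinct from the starting node). For a node $[s,r]$ (the starting node being treated as $s=r=0$) and each pair of digits $(c,a)$, $0\le a,c\le g-1$, with $ka+r\equiv c \pmod g$ and $0\le a+sg-kc\le k-1$, there is a directed edge labelled $(c,a)$ from $[s,r]$ to the node $[\,a+sg-kc,\ (ka+r-c)/g\,]$; for edges leaving the starting node one additionally requires $a\ne0$ and $c\ne0$. $H(g,k)$ consists of the starting node, the nodes reachable from it by directed paths, and all edges leaving these nodes. A non-starting node of the form $[r,r]$ ($r\ge0$, including $[0,0]$) is an even pivot node; a non-starting node is an odd pivot node if it is of the form $[r,r]$ and carries a loop, or is of the form $[r',r]$ with $r'\ne r$ and has an edge to $[r,r']$. The $(g,k)$ Young graph exists if $H(g,k)$ contains a node $[r,r]$ with $r\ne0$ or an edge $[r',r]\to[r,r']$ with $r'\ne r$; it is then obtained from $H(g,k)$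 by deleting every node from which no pivot node can be reached by a directed path, together with all edges incident to such nodes. Complete graph $K_m$: a Young graph is the complete graph $K_m$ if it has exactly $m$ non-starting nodes, there is a directed edge from every non-starting node to every non-starting node (including a loop at each non-starting node), and the starting node has an edge to every non-starting node except $[0,0]$. -}

module Defs where

open import Data.Nat using (ℕ; zero; suc; _+_; _*_; _∸_; _^_; _≤_; _<_)
open import Data.List using (List; []; _∷_; _++_; [_]; length; reverse)
open import Data.List.Relation.Unary.All using (All)
open import Data.List.Relation.Unary.Unique.Propositional using (Unique)
open import Data.List.Membership.Propositional using (_∈_)
open import Data.Product using (Σ; ∃; ∃-syntax; _×_; _,_)
open import Data.Sum using (_⊎_)
open import Data.Unit using (⊤)
open import Data.Empty using (⊥)
open import Function.Bundles using (_⇔_)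
open import Relation.Binary.PropositionalEquality using (_≡_; _≢_)
open import Relation.Binary.Construct.Closure.ReflexiveTransitive using (Star)

-- Base-g numerals.  A digit list is little-endian: [a₀, a₁, …, aₙ₋₁]
-- represents (aₙ₋₁,…,a₁,a₀)_g = Σ aᵢ gⁱ.

val : ℕ → List ℕ → ℕ
val g []       = 0
val g (d ∷ ds) = d + g * val g ds

LeadingNonzero : List ℕ → Set
LeadingNonzero ds = ∃[ ds' ] ∃[ d ] (ds ≡ ds' ++ [ d ] × d ≢ 0)

RevMultLen : ℕ → ℕ → ℕ → ℕ → Set
RevMultLen g k t N =
  Σ (List ℕ) λ ds →
    length ds ≡ t × All (_< g) ds × LeadingNonzero ds ×
    N ≡ val g ds × k * N ≡ val g (reverse ds)

RevMult : ℕ → ℕ → ℕ → Set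
RevMult g k N = ∃[ t ] RevMultLen g k t N

HasCard : (ℕ → Set) → ℕ → Set
HasCard P n = Σ (List ℕ) λ L → length L ≡ n × Unique L × (∀ x → P x ⇔ (x ∈ L))

RevCount : ℕ → ℕ → ℕ → ℕ → Set
RevCount g k t n = HasCard (RevMultLen g k t) n

data Node : Set where
  start : Node
  pair  : ℕ → ℕ → Node

sOf : Node → ℕ
sOf start      = 0
sOf (pair s r) = s

rOf : Node → ℕ
rOf start      = 0
rOf (pair s r) = r

StartCond : Node → ℕ → ℕ → Set
StartCond start      c a = a ≢ 0 × c ≢ 0
StartCond (pair _ _) c a = ⊤

-- With s = sOf u, r = rOf u, conditions: a,c < g, k a + r ≡ c (mod g),
-- 0 ≤ a + s g − k c ≤ k − 1, and v = [a + s g − k c, (k a + r − c)/g].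
-- (k a + r − c is divisible by g and > −g, hence ≥ 0; we encode
--  s' = a + s g − k c and r' = (k a + r − c)/g by the exact equations.)
Edge : ℕ → ℕ → Node → ℕ → ℕ → Node → Set
Edge g k u c a v =
  a < g × c < g × StartCond u c a ×
  ∃[ s' ] ∃[ r' ]
    (a + sOf u * g ≡ k * c + s' × s' ≤ k ∸ 1 ×
     k * a + rOf u ≡ c + g * r' × v ≡ pair s' r')

Step : ℕ → ℕ → Node → Node → Set
Step g k u v = ∃[ c ] ∃[ a ] Edge g k u c a v

Path : ℕ → ℕ → Node → Node → Set
Path g k = Star (Step g k)

InH : ℕ → ℕ → Node → Set
InH g k v = Path g k start v

EvenPivot : Node → Set
EvenPivot start      = ⊥
EvenPivot (pair s r) = s ≡ r

OddPivot : ℕ → ℕ → Node → Set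
OddPivot g k start      = ⊥
OddPivot g k (pair s r) =
  (s ≡ r × Step g k (pair s r) (pair s r)) ⊎
  (s ≢ r × Step g k (pair s r) (pair r s))

Pivot : ℕ → ℕ → Node → Set
Pivot g k v = EvenPivot v ⊎ OddPivot g k v

YoungExists : ℕ → ℕ → Set
YoungExists g k =
  (∃[ r ] (r ≢ 0 × InH g k (pair r r))) ⊎
  (∃[ r' ] ∃[ r ] (r' ≢ r × InH g k (pair r' r) × Step g k (pair r' r) (pair r r')))

YNode : ℕ → ℕ → Node → Set
YNode g k v = InH g k v × ∃[ w ] (Path g k v w × Pivot g k w)

YEdge : ℕ → ℕ → Node → ℕ → ℕ → Node → Set
YEdge g k u c a v = YNode g k u × YNode g k v × Edge g k u c a v

IsCompleteYoung : ℕ → ℕ → ℕ → Set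
IsCompleteYoung g k m =
  YoungExists g k ×
  HasCardPairs ×
  (∀ s r s₁ r₁ → YNode g k (pair s r) → YNode g k (pair s₁ r₁) →
     ∃[ c ] ∃[ a ] YEdge g k (pair s r) c a (pair s₁ r₁)) ×
  (∀ s r → YNode g k (pair s r) → pair s r ≢ pair 0 0 →
     ∃[ c ] ∃[ a ] YEdge g k start c a (pair s r))
  where
  HasCardPairs : Set
  HasCardPairs =
    Σ (List (ℕ × ℕ)) λ L → length L ≡ m × Unique L ×
      (∀ s r → YNode g k (pair s r) ⇔ ((s , r) ∈ L))

GoodR : ℕ → ℕ → ℕ → Set
GoodR g k r =
  0 < r ×
  ∃[ a ] ∃[ b ] (a * (k * k ∸ 1) ≡ r * (k * g ∸ 1) ×
                 b * (k * k ∸ 1) ≡ r * (g ∸ k) ×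
                 0 < a × 0 < b × a < g)

Label : ℕ → ℕ → ℕ → ℕ → ℕ → Set
Label g k j c a = c * (k * k ∸ 1) ≡ j * (g ∸ k) × a * (k * k ∸ 1) ≡ j * (k * g ∸ 1)

PalinDigits : ℕ → ℕ → ℕ → Set
PalinDigits g m β =
  Σ (List ℕ) λ ds →
    All (_< g) ds × All (_< m) ds × LeadingNonzero ds ×
    reverse ds ≡ ds × β ≡ val g ds

module Submission where

-- Let r₀ be the least good value and put C = r₀(g−k)/(k²−1), A = r₀(kg−1)/(k²−1).
-- These satisfy the two digit identities  A = kC + r₀  and  kA = C + g r₀; in
-- particular k(A + gC) = C + gA, so k reverses the two-digit number γ = (C, A)_g.
--  1. Every good value is a multiple q r₀ with qA < g (otherwise its remainder modulo
--     r₀ would be a smaller good value); as there are m − 1 good values, pigeonhole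
--     gives (m−1)A < g, whence i r₀ < k and iA + jC < g for all i, j < m.
--  2. Then the "rungs" [i r₀, i r₀] (i < m) form a complete graph: [j r₀, j r₀] → [i r₀, i r₀]
--     is an edge labelled (iC + jA, iA + jC), and the two carry equations force this
--     label.  The m rungs are Young nodes, so by counting they are all of them (part (i)).
--  3. Reading k N = reverse N from both ends walks through H(g,k) from the start node;
--     every node met is a Young node, hence a rung, so all digits are forced and N = γβ
--     for a palindrome β over the digits 0, …, m−1; conversely every such γβ is a
--     reverse multiple (part (iii)).
--  4. Enumerating those palindromes length by length gives the coefficients of C(x)
--     (part (ii)).

open import Defs
open import Data.Nat using (ℕ; zero; suc; _+_; _*_; _∸_; _^_; _≤_; _<_; z≤n; s≤s; _≟_; _<?_; NonZero; >-nonZero)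
open import Data.Nat.Properties
open import Data.Nat.DivMod using (_/_; _%_; m≡m%n+[m/n]*n; m%n<n)
open import Data.Nat.Tactic.RingSolver using (solve-∀)
open import Data.List using (List; []; _∷_; _++_; [_]; length; reverse; map; upTo; cartesianProductWith; initLast; _∷ʳ′_)
open import Data.List.Properties
  using (∷-injective; ∷ʳ-injective; length-++; reverse-++; unfold-reverse; length-reverse; length-map; length-upTo; ++-assoc)
open import Data.List.Relation.Unary.All using (All; []; _∷_)
import Data.List.Relation.Unary.All as All
import Data.List.Relation.Unary.All.Properties as AllP
open import Data.List.Relation.Unary.Any using (here; there)
open import Data.List.Relation.Unary.AllPairs using (_∷_)
open import Data.List.Relation.Unary.Unique.Propositional using (Unique; [])
import Data.List.Relation.Unary.Unique.Propositional.Properties as Unique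
open import Data.List.Relation.Binary.Permutation.Propositional using (↭-sym)
open import Data.List.Relation.Binary.Permutation.Propositional.Properties using (All-resp-↭; ↭-reverse)
open import Data.List.Membership.Propositional using (_∈_)
open import Data.List.Membership.Propositional.Properties
  using (∈-map⁺; ∈-map⁻; ∈-upTo⁺; ∈-upTo⁻; ∈-cartesianProductWith⁺; ∈-cartesianProductWith⁻)
import Data.List.Membership.DecPropositional as DecMembership
import Data.Product.Properties as Product
open import Data.Product using (∃-syntax; _×_; _,_; proj₁; proj₂)
open import Data.Sum using (inj₁; inj₂)
open import Data.Unit using (tt)
open import Data.Empty using (⊥; ⊥-elim)
open import Function.Bundles using (_⇔_; mk⇔; Equivalence)
open import Relation.Nullary using (¬_; yes; no)
open import Relation.Binary.PropositionalEquality hiding ([_])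
open import Relation.Binary.Construct.Closure.ReflexiveTransitive using (ε; _◅_; _◅◅_)

-- Two-ended view of a list: empty, a single element, or first ∷ middle ∷ʳ last.
-- Reverse multiples and palindromes are analysed from both ends at once.
data Ends {A : Set} : List A → Set where
  none   : Ends []
  single : ∀ x → Ends [ x ]
  outer  : ∀ x mid y → Ends (x ∷ mid ++ [ y ])

ends : {A : Set} (xs : List A) → Ends xs
ends []       = none
ends (x ∷ xs) with initLast xs
... | []         = single x
... | mid ∷ʳ′ y  = outer x mid y

reverse-outer : {A : Set} (x : A) (mid : List A) (y : A) →
  reverse (x ∷ mid ++ [ y ]) ≡ y ∷ reverse mid ++ [ x ]
reverse-outer x mid y = trans (unfold-reverse x (mid ++ [ y ])) (cong (_++ [ x ]) (reverse-++ mid [ y ]))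

length-outer : {A : Set} (x : A) (mid : List A) (y : A) → length (x ∷ mid ++ [ y ]) ≡ suc (suc (length mid))
length-outer x mid y = cong suc (trans (length-++ mid) (+-comm (length mid) 1))

outer-length≢1 : {A : Set} (x : A) (mid : List A) (y : A) → length (x ∷ mid ++ [ y ]) ≢ 1
outer-length≢1 x mid y e with trans (sym (length-outer x mid y)) e
... | ()

palindrome-outer : {A : Set} (x : A) (mid : List A) (y : A) →
  reverse (x ∷ mid ++ [ y ]) ≡ x ∷ mid ++ [ y ] → y ≡ x × reverse mid ≡ mid
palindrome-outer x mid y pal with ∷-injective (trans (sym (reverse-outer x mid y)) pal)
... | y≡x , e = y≡x , proj₁ (∷ʳ-injective (reverse mid) mid e)

All-reverse : {P : ℕ → Set} (xs : List ℕ) → All P xs → All P (reverse xs)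
All-reverse xs = All-resp-↭ (↭-sym (↭-reverse xs))

snoc-nonempty : {A : Set} (xs : List A) (y : A) → [] ≢ xs ++ [ y ]
snoc-nonempty []      y ()
snoc-nonempty (_ ∷ _) y ()

leading-nonempty : ¬ LeadingNonzero []
leading-nonempty (xs , x , e , _) = snoc-nonempty xs x e

leading-last : ∀ xs y → LeadingNonzero (xs ++ [ y ]) → y ≢ 0
leading-last xs y (ds' , d , e , d≢0) y≡0 = d≢0 (trans (sym (proj₂ (∷ʳ-injective xs ds' e))) y≡0)

remove : {A : Set} {x : A} (ys : List A) → x ∈ ys → List A
remove (y ∷ ys) (here _)  = ys
remove (y ∷ ys) (there p) = y ∷ remove ys p

length-remove : {A : Set} {x : A} (ys : List A) (p : x ∈ ys) → suc (length (remove ys p)) ≡ length ys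
length-remove (y ∷ ys) (here _)  = refl
length-remove (y ∷ ys) (there p) = cong suc (length-remove ys p)

∈-remove : {A : Set} {x z : A} (ys : List A) (p : x ∈ ys) → z ∈ ys → z ≢ x → z ∈ remove ys p
∈-remove (y ∷ ys) (here refl) (here refl) z≢x = ⊥-elim (z≢x refl)
∈-remove (y ∷ ys) (here refl) (there q)   _   = q
∈-remove (y ∷ ys) (there p)   (here refl) _   = here refl
∈-remove (y ∷ ys) (there p)   (there q)   z≢x = there (∈-remove ys p q z≢x)

unique-⊆-length : {A : Set} (xs ys : List A) → Unique xs → (∀ {x} → x ∈ xs → x ∈ ys) → length xs ≤ length ys
unique-⊆-length []       ys _          _   = z≤n
unique-⊆-length (x ∷ xs) ys (x∉ ∷ u) xs⊆ys = begin
    suc (length xs)               ≤⟨ s≤s (unique-⊆-length xs (remove ys x∈ys) u xs⊆rest) ⟩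
    suc (length (remove ys x∈ys)) ≡⟨ length-remove ys x∈ys ⟩
    length ys                     ∎
  where
  open ≤-Reasoning
  x∈ys = xs⊆ys (here refl)
  xs⊆rest : ∀ {z} → z ∈ xs → z ∈ remove ys x∈ys
  xs⊆rest z∈xs = ∈-remove ys x∈ys (xs⊆ys (there z∈xs)) (λ z≡x → All.lookup x∉ z∈xs (sym z≡x))

unique-map : {A B : Set} (f : A → B) (xs : List A) → Unique xs →
  (∀ {x y} → x ∈ xs → y ∈ xs → f x ≡ f y → x ≡ y) → Unique (map f xs)
unique-map f []       []        _   = []
unique-map f (x ∷ xs) (x∉ ∷ u) inj = fresh xs x∉ (λ q → q) ∷ unique-map f xs u (λ p q → inj (there p) (there q))
  where
  fresh : ∀ ys → All (x ≢_) ys → (∀ {y} → y ∈ ys → y ∈ xs) → All (f x ≢_) (map f ys)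
  fresh []       []        _   = []
  fresh (y ∷ ys) (x≢y ∷ ns) sub =
    (λ e → x≢y (inj (here refl) (there (sub (here refl))) e)) ∷ fresh ys ns (λ q → sub (there q))

length-cartesianProductWith : {A B C : Set} (f : A → B → C) (xs : List A) (ys : List B) →
  length (cartesianProductWith f xs ys) ≡ length xs * length ys
length-cartesianProductWith f []       ys = refl
length-cartesianProductWith f (x ∷ xs) ys =
  trans (length-++ (map (f x) ys)) (cong₂ _+_ (length-map (f x) ys) (length-cartesianProductWith f xs ys))

val-single : ∀ g x → val g [ x ] ≡ x
val-single g x = trans (cong (x +_) (*-zeroʳ g)) (+-identityʳ x)

val-snoc : ∀ g xs y → val g (xs ++ [ y ]) ≡ val g xs + g ^ length xs * y
val-snoc g []       y = cong (y +_) (*-zeroʳ g)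
val-snoc g (x ∷ xs) y = begin
    x + g * val g (xs ++ [ y ])              ≡⟨ cong (λ t → x + g * t) (val-snoc g xs y) ⟩
    x + g * (val g xs + g ^ length xs * y)   ≡⟨ shift x g (val g xs) (g ^ length xs) y ⟩
    (x + g * val g xs) + (g * g ^ length xs) * y ∎
  where
  open ≡-Reasoning
  shift : ∀ x g v G y → x + g * (v + G * y) ≡ (x + g * v) + (g * G) * y
  shift = solve-∀

val-bound : ∀ g xs → All (_< g) xs → val g xs < g ^ length xs
val-bound g []       []          = s≤s z≤n
val-bound g (x ∷ xs) (x<g ∷ xs<g) = begin-strict
    x + g * val g xs   <⟨ +-monoˡ-< (g * val g xs) x<g ⟩
    g + g * val g xs   ≡⟨ sym (*-suc g (val g xs)) ⟩
    g * suc (val g xs) ≤⟨ *-monoʳ-≤ g (val-bound g xs xs<g) ⟩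
    g * g ^ length xs  ∎
  where open ≤-Reasoning

val-reverse-bound : ∀ g xs → All (_< g) xs → val g (reverse xs) < g ^ length xs
val-reverse-bound g xs xs<g =
  subst (λ n → val g (reverse xs) < g ^ n) (length-reverse xs) (val-bound g (reverse xs) (All-reverse xs xs<g))

-- Uniqueness of division with remainder, in the shape met when carries are peeled
-- off: from P + g X = y + g Y with y < g, the excess of Y over X is the quotient of P.
carry-split : ∀ g P X y Y → y < g → P + g * X ≡ y + g * Y → ∃[ q ] (P ≡ y + g * q × Y ≡ X + q)
carry-split g P X y Y y<g eq with ≤-<-connex X Y
... | inj₁ X≤Y with m≤n⇒∃[o]m+o≡n X≤Y
...   | q , refl = q , +-cancelʳ-≡ (g * X) P (y + g * q) (trans eq (regroup y g X q)) , refl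
  where
  regroup : ∀ y g X q → y + g * (X + q) ≡ (y + g * q) + g * X
  regroup = solve-∀
carry-split g P X y Y y<g eq | inj₂ Y<X with m≤n⇒∃[o]m+o≡n Y<X
... | q , refl = ⊥-elim (<⇒≱ y<g g≤y)
  where
  regroup : ∀ P g Y q → P + g * (suc Y + q) ≡ (P + g * suc q) + g * Y
  regroup = solve-∀
  y≡ : P + g * suc q ≡ y
  y≡ = +-cancelʳ-≡ (g * Y) (P + g * suc q) y (trans (sym (regroup P g Y q)) eq)
  g≤y : g ≤ y
  g≤y = ≤-trans (m≤m*n g (suc q)) (≤-trans (m≤n+m (g * suc q) P) (≤-reflexive y≡))

val-injective : ∀ g xs ys → length xs ≡ length ys → All (_< g) xs → All (_< g) ys → val g xs ≡ val g ys → xs ≡ ys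
val-injective g []       []       _   _          _          _ = refl
val-injective g (x ∷ xs) (y ∷ ys) len (x<g ∷ xs<g) (y<g ∷ ys<g) eq
  with carry-split g x (val g xs) y (val g ys) y<g eq
... | zero  , x≡y , vys≡ = cong₂ _∷_ (trans x≡y (trans (cong (y +_) (*-zeroʳ g)) (+-identityʳ y)))
    (val-injective g xs ys (suc-injective len) xs<g ys<g (sym (trans vys≡ (+-identityʳ (val g xs)))))
... | suc q , x≡ , _ = ⊥-elim (<⇒≱ x<g (≤-trans (m≤m*n g (suc q)) (≤-trans (m≤n+m (g * suc q) y) (≤-reflexive (sym x≡)))))

-- Defs bounds carries by k ∸ 1; these convert to and from strict bounds.
<⇒≤∸1 : ∀ {a b} → a < b → a ≤ b ∸ 1
<⇒≤∸1 {b = suc b} (s≤s a≤b) = a≤b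

≤∸1⇒< : ∀ {a b} → 0 < b → a ≤ b ∸ 1 → a < b
≤∸1⇒< {b = suc b} _ a≤b = s≤s a≤b

scaling-fixpoint : ∀ {c} n → 2 ≤ c → c * n ≡ n → n ≡ 0
scaling-fixpoint zero    _   _ = refl
scaling-fixpoint {c} (suc n) 2≤c e = ⊥-elim (<-irrefl refl (begin-strict
    suc n     <⟨ m<m*n (suc n) c 2≤c ⟩
    suc n * c ≡⟨ *-comm (suc n) c ⟩
    c * suc n ≡⟨ e ⟩
    suc n     ∎))
  where open ≤-Reasoning

-- The system  x − k y = const,  k x − y = const  (determinant k² − 1 ≠ 0) has at most
-- one solution in ℕ; stated in cancelled form for two candidate solutions, first
-- under the extra assumption y ≤ y₀, which writes y₀ = y + δ and forces δ = k² δ.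
system-unique-≤ : ∀ k → 2 ≤ k → ∀ x y x₀ y₀ → x + k * y₀ ≡ x₀ + k * y → k * x + y₀ ≡ k * x₀ + y → y ≤ y₀ →
  x ≡ x₀ × y ≡ y₀
system-unique-≤ k 2≤k x y x₀ y₀ e₁ e₂ y≤y₀ with m≤n⇒∃[o]m+o≡n y≤y₀
... | δ , refl = x≡x₀ , sym (trans (cong (y +_) δ≡0) (+-identityʳ y))
  where
  x₀≡ : x + k * δ ≡ x₀
  x₀≡ = +-cancelʳ-≡ (k * y) (x + k * δ) x₀ (trans (regroup x k y δ) e₁)
    where
    regroup : ∀ x k y δ → (x + k * δ) + k * y ≡ x + k * (y + δ)
    regroup = solve-∀
  kkδ≡δ : (k * k) * δ ≡ δ
  kkδ≡δ = +-cancelˡ-≡ (k * x + y) ((k * k) * δ) δ (begin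
      (k * x + y) + (k * k) * δ ≡⟨ regroup k x y δ ⟩
      k * (x + k * δ) + y       ≡⟨ cong (λ t → k * t + y) x₀≡ ⟩
      k * x₀ + y                ≡⟨ sym e₂ ⟩
      k * x + (y + δ)           ≡⟨ sym (+-assoc (k * x) y δ) ⟩
      (k * x + y) + δ           ∎)
    where
    open ≡-Reasoning
    regroup : ∀ k x y δ → (k * x + y) + (k * k) * δ ≡ k * (x + k * δ) + y
    regroup = solve-∀
  δ≡0 : δ ≡ 0
  δ≡0 = scaling-fixpoint δ (*-mono-≤ 2≤k (≤-trans (s≤s z≤n) 2≤k)) kkδ≡δ
  x≡x₀ : x ≡ x₀
  x≡x₀ = trans (sym (trans (cong (λ t → x + k * t) δ≡0) (trans (cong (x +_) (*-zeroʳ k)) (+-identityʳ x)))) x₀≡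

system-unique : ∀ k → 2 ≤ k → ∀ x y x₀ y₀ → x + k * y₀ ≡ x₀ + k * y → k * x + y₀ ≡ k * x₀ + y → x ≡ x₀ × y ≡ y₀
system-unique k 2≤k x y x₀ y₀ e₁ e₂ with ≤-total y y₀
... | inj₁ y≤y₀ = system-unique-≤ k 2≤k x y x₀ y₀ e₁ e₂ y≤y₀
... | inj₂ y₀≤y with system-unique-≤ k 2≤k x₀ y₀ x y (sym e₁) (sym e₂) y₀≤y
...   | x₀≡x , y₀≡y = sym x₀≡x , sym y₀≡y

-- A digit X on which multiplication by k ≥ 2 acts like a loop of the carry
-- automaton (k X + R = X + g R with carry R < k) is a genuine digit: X < g.
loop-digit-bound : ∀ k X R g → 2 ≤ k → R < k → 0 < g → k * X + R ≡ X + g * R → X < g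
loop-digit-bound (suc k') X R g (s≤s 1≤k') (s≤s R≤k') g>0 e with X <? g
... | yes X<g = X<g
... | no X≮g = ⊥-elim (<-irrefl refl (begin-strict
    0          <⟨ *-mono-≤ 1≤k' (≤-trans g>0 g≤X) ⟩
    k' * X     ≡⟨ sym (+-identityʳ (k' * X)) ⟩
    k' * X + 0 ≡⟨ cong (k' * X +_) (sym R≡0) ⟩
    k' * X + R ≡⟨ k'X+R≡ ⟩
    g * R      ≡⟨ cong (g *_) R≡0 ⟩
    g * 0      ≡⟨ *-zeroʳ g ⟩
    0          ∎))
  where
  open ≤-Reasoning
  g≤X : g ≤ X
  g≤X = ≮⇒≥ X≮g
  k'X+R≡ : k' * X + R ≡ g * R
  k'X+R≡ = +-cancelˡ-≡ X (k' * X + R) (g * R) (trans (sym (+-assoc X (k' * X) R)) e)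
  R≡0 : R ≡ 0
  R≡0 = n≤0⇒n≡0 (+-cancelˡ-≤ (k' * X) R 0 (begin
      k' * X + R ≡⟨ k'X+R≡ ⟩
      g * R      ≤⟨ *-monoʳ-≤ g R≤k' ⟩
      g * k'     ≡⟨ *-comm g k' ⟩
      k' * g     ≤⟨ *-monoʳ-≤ k' g≤X ⟩
      k' * X     ≡⟨ sym (+-identityʳ (k' * X)) ⟩
      k' * X + 0 ∎))

difference-equal : ∀ a b a' b' P Q → a + P ≡ b + Q → a' + P ≡ b' + Q → a + b' ≡ a' + b
difference-equal a b a' b' P Q e e' = +-cancelʳ-≡ (P + Q) (a + b') (a' + b) (begin
    (a + b') + (P + Q) ≡⟨ regroup a b' P Q ⟩
    (a + P) + (b' + Q) ≡⟨ cong₂ _+_ e (sym e') ⟩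
    (b + Q) + (a' + P) ≡⟨ regroup' b Q a' P ⟩
    (a' + b) + (P + Q) ∎)
  where
  open ≡-Reasoning
  regroup : ∀ a b' P Q → (a + b') + (P + Q) ≡ (a + P) + (b' + Q)
  regroup = solve-∀
  regroup' : ∀ b Q a' P → (b + Q) + (a' + P) ≡ (a' + b) + (P + Q)
  regroup' = solve-∀

carry-bound : ∀ {g k} x r y r' → x < g → r < k → k * x + r ≡ y + g * r' → r' < k
carry-bound {g} {k} x r y r' x<g r<k e = *-cancelˡ-< g r' k (begin-strict
    g * r'      ≤⟨ m≤n+m (g * r') y ⟩
    y + g * r'  ≡⟨ sym e ⟩
    k * x + r   <⟨ +-monoʳ-< (k * x) r<k ⟩
    k * x + k   ≡⟨ +-comm (k * x) k ⟩
    k + k * x   ≡⟨ sym (*-suc k x) ⟩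
    k * suc x   ≤⟨ *-monoʳ-≤ k x<g ⟩
    k * g       ≡⟨ *-comm k g ⟩
    g * k       ∎)
  where open ≤-Reasoning

-- One step of reading k·N = reverse N from both ends.
carry-step : ∀ g k s r x y G M M' → x < g → y < g → r < k → M < G → M' < G →
  k * (x + g * (M + G * y)) + r ≡ (y + g * (M' + G * x)) + s * (g * (g * G)) →
  ∃[ s' ] ∃[ r' ] (x + s * g ≡ k * y + s' × s' < k × k * x + r ≡ y + g * r' × r' < k ×
                   k * M + r' ≡ M' + s' * G)
carry-step g k s r x y G M M' x<g y<g r<k M<G M'<G e
  with carry-split g (k * x + r) (k * M + G * (k * y)) y (M' + G * (x + s * g)) y<g
         (trans (lowEnd k x g M G y r) (trans e (highEnd y g M' G x s)))
  where
  lowEnd : ∀ k x g M G y r → (k * x + r) + g * (k * M + G * (k * y)) ≡ k * (x + g * (M + G * y)) + r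
  lowEnd = solve-∀
  highEnd : ∀ y g M' G x s → (y + g * (M' + G * x)) + s * (g * (g * G)) ≡ y + g * (M' + G * (x + s * g))
  highEnd = solve-∀
... | r' , kx+r≡ , middle≡
  with carry-split G (r' + k * M) (k * y) M' (x + s * g) M'<G
         (trans (+-assoc r' (k * M) (G * (k * y))) (trans (+-comm r' _) (sym middle≡)))
... | s' , middle-carry , x+sg≡ = s' , r' , x+sg≡ , s'<k , kx+r≡ , r'<k , kM+r'≡
  where
  r'<k : r' < k
  r'<k = carry-bound x r y r' x<g r<k kx+r≡
  kM+r'≡ : k * M + r' ≡ M' + s' * G
  kM+r'≡ = trans (+-comm (k * M) r') (trans middle-carry (cong (M' +_) (*-comm G s')))
  s'<k : s' < k
  s'<k = carry-bound M r' M' s' M<G r'<k (trans kM+r'≡ (cong (M' +_) (*-comm s' G)))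

module DigitIdentities (g k r₀ A C : ℕ) (A≡ : A ≡ k * C + r₀) (kA≡ : k * A ≡ C + g * r₀) where

  -- The two carry equations of the edge [j r₀, j r₀] → [i r₀, i r₀] labelled
  -- (iC + jA, iA + jC).
  edge-carry-s : ∀ i j → (i * A + j * C) + j * r₀ * g ≡ k * (i * C + j * A) + i * r₀
  edge-carry-s i j = begin
      (i * A + j * C) + j * r₀ * g           ≡⟨ cong (λ t → (i * t + j * C) + j * r₀ * g) A≡ ⟩
      (i * (k * C + r₀) + j * C) + j * r₀ * g ≡⟨ expand i k C r₀ j g ⟩
      k * (i * C) + j * (C + g * r₀) + i * r₀ ≡⟨ cong (λ t → k * (i * C) + j * t + i * r₀) (sym kA≡) ⟩
      k * (i * C) + j * (k * A) + i * r₀      ≡⟨ collect k i C j A r₀ ⟩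
      k * (i * C + j * A) + i * r₀            ∎
    where
    open ≡-Reasoning
    expand : ∀ i k C r₀ j g → (i * (k * C + r₀) + j * C) + j * r₀ * g ≡ k * (i * C) + j * (C + g * r₀) + i * r₀
    expand = solve-∀
    collect : ∀ k i C j A r₀ → k * (i * C) + j * (k * A) + i * r₀ ≡ k * (i * C + j * A) + i * r₀
    collect = solve-∀

  edge-carry-r : ∀ i j → k * (i * A + j * C) + j * r₀ ≡ (i * C + j * A) + g * (i * r₀)
  edge-carry-r i j = begin
      k * (i * A + j * C) + j * r₀     ≡⟨ expand k i A j C r₀ ⟩
      i * (k * A) + j * (k * C + r₀)   ≡⟨ cong₂ (λ t u → i * t + j * u) kA≡ (sym A≡) ⟩
      i * (C + g * r₀) + j * A         ≡⟨ collect i C g r₀ j A ⟩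
      (i * C + j * A) + g * (i * r₀)   ∎
    where
    open ≡-Reasoning
    expand : ∀ k i A j C r₀ → k * (i * A + j * C) + j * r₀ ≡ i * (k * A) + j * (k * C + r₀)
    expand = solve-∀
    collect : ∀ i C g r₀ j A → i * (C + g * r₀) + j * A ≡ (i * C + j * A) + g * (i * r₀)
    collect = solve-∀

  -- Conversely, any edge from [j r₀, j r₀] to [i r₀, i r₀] carries that label.
  forced-label : 2 ≤ k → ∀ i j x y → x + i * r₀ * g ≡ k * y + j * r₀ → k * x + i * r₀ ≡ y + g * (j * r₀) →
    x ≡ j * A + i * C × y ≡ j * C + i * A
  forced-label 2≤k i j x y e₁ e₂ = system-unique k 2≤k x y (j * A + i * C) (j * C + i * A)
    (difference-equal x (k * y) (j * A + i * C) (k * (j * C + i * A)) (i * r₀ * g) (j * r₀) e₁ (edge-carry-s j i))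
    (difference-equal (k * x) y (k * (j * A + i * C)) (j * C + i * A) (i * r₀) (g * (j * r₀)) e₂ (edge-carry-r j i))

  k-reverses-γ : ∀ V → k * ((A + g * C) * V) ≡ (C + g * A) * V
  k-reverses-γ V = begin
      k * ((A + g * C) * V)             ≡⟨ expand k A g C V ⟩
      (k * A + g * (k * C)) * V         ≡⟨ cong (λ t → (t + g * (k * C)) * V) kA≡ ⟩
      ((C + g * r₀) + g * (k * C)) * V  ≡⟨ collect C g r₀ k V ⟩
      (C + g * (k * C + r₀)) * V        ≡⟨ cong (λ t → (C + g * t) * V) (sym A≡) ⟩
      (C + g * A) * V                   ∎
    where
    open ≡-Reasoning
    expand : ∀ k A g C V → k * ((A + g * C) * V) ≡ (k * A + g * (k * C)) * V
    expand = solve-∀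
    collect : ∀ C g r₀ k V → ((C + g * r₀) + g * (k * C)) * V ≡ (C + g * (k * C + r₀)) * V
    collect = solve-∀

module GoodValues (g k : ℕ) (2≤k : 2 ≤ k) (k<g : k < g) where

  d : ℕ
  d = k * k ∸ 1

  1≤kk : 1 ≤ k * k
  1≤kk = *-mono-≤ (≤-trans (s≤s z≤n) 2≤k) (≤-trans (s≤s z≤n) 2≤k)

  instance
    d-nonZero : NonZero d
    d-nonZero = >-nonZero (∸-monoˡ-≤ 1 (*-mono-≤ 2≤k (≤-trans (s≤s z≤n) 2≤k)))

  kg∸1≡ : k * (g ∸ k) + d ≡ k * g ∸ 1
  kg∸1≡ = sym (begin
      k * g ∸ 1                     ≡⟨ cong (_∸ 1) (sym (m∸n+n≡m (*-monoʳ-≤ k (<⇒≤ k<g)))) ⟩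
      ((k * g ∸ k * k) + k * k) ∸ 1 ≡⟨ +-∸-assoc (k * g ∸ k * k) 1≤kk ⟩
      (k * g ∸ k * k) + d           ≡⟨ cong (_+ d) (sym (*-distribˡ-∸ k g k)) ⟩
      k * (g ∸ k) + d               ∎)
    where open ≡-Reasoning

  good-a : ∀ r a b → a * d ≡ r * (k * g ∸ 1) → b * d ≡ r * (g ∸ k) → a ≡ k * b + r
  good-a r a b ha hb = *-cancelʳ-≡ a (k * b + r) d (begin
      a * d                  ≡⟨ ha ⟩
      r * (k * g ∸ 1)        ≡⟨ cong (r *_) (sym kg∸1≡) ⟩
      r * (k * (g ∸ k) + d)  ≡⟨ expand r k (g ∸ k) d ⟩
      k * (r * (g ∸ k)) + r * d ≡⟨ cong (λ t → k * t + r * d) (sym hb) ⟩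
      k * (b * d) + r * d    ≡⟨ collect k b d r ⟩
      (k * b + r) * d        ∎)
    where
    open ≡-Reasoning
    expand : ∀ r k G d → r * (k * G + d) ≡ k * (r * G) + r * d
    expand = solve-∀
    collect : ∀ k b d r → k * (b * d) + r * d ≡ (k * b + r) * d
    collect = solve-∀

  proportional : ∀ r b r' b' → b * d ≡ r * (g ∸ k) → b' * d ≡ r' * (g ∸ k) → r' * b ≡ r * b'
  proportional r b r' b' hb hb' = *-cancelʳ-≡ (r' * b) (r * b') d (begin
      (r' * b) * d        ≡⟨ *-assoc r' b d ⟩
      r' * (b * d)        ≡⟨ cong (r' *_) hb ⟩
      r' * (r * (g ∸ k))  ≡⟨ swap r' r (g ∸ k) ⟩
      r * (r' * (g ∸ k))  ≡⟨ cong (r *_) (sym hb') ⟩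
      r * (b' * d)        ≡⟨ sym (*-assoc r b' d) ⟩
      (r * b') * d        ∎)
    where
    open ≡-Reasoning
    swap : ∀ r' r G → r' * (r * G) ≡ r * (r' * G)
    swap = solve-∀

  good-intro : ∀ r b → 0 < r → 0 < b → b * d ≡ r * (g ∸ k) → k * b + r < g → GoodR g k r
  good-intro r b r>0 b>0 hb a<g = r>0 , k * b + r , b , ha , hb , ≤-trans r>0 (m≤n+m r (k * b)) , b>0 , a<g
    where
    ha : (k * b + r) * d ≡ r * (k * g ∸ 1)
    ha = begin
        (k * b + r) * d           ≡⟨ expand k b r d ⟩
        k * (b * d) + r * d       ≡⟨ cong (λ t → k * t + r * d) hb ⟩
        k * (r * (g ∸ k)) + r * d ≡⟨ collect k r (g ∸ k) d ⟩
        r * (k * (g ∸ k) + d)     ≡⟨ cong (r *_) kg∸1≡ ⟩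
        r * (k * g ∸ 1)           ∎
      where
      open ≡-Reasoning
      expand : ∀ k b r d → (k * b + r) * d ≡ k * (b * d) + r * d
      expand = solve-∀
      collect : ∀ k r G d → k * (r * G) + r * d ≡ r * (k * G + d)
      collect = solve-∀

  module RelativeTo (r₀ : ℕ) (good₀ : GoodR g k r₀) where

    r₀>0 : 0 < r₀
    r₀>0 = proj₁ good₀

    instance
      r₀-nonZero : NonZero r₀
      r₀-nonZero = >-nonZero r₀>0

    A C : ℕ
    A = proj₁ (proj₂ good₀)
    C = proj₁ (proj₂ (proj₂ good₀))

    A-def : A * d ≡ r₀ * (k * g ∸ 1)
    A-def = proj₁ (proj₂ (proj₂ (proj₂ good₀)))

    C-def : C * d ≡ r₀ * (g ∸ k)
    C-def = proj₁ (proj₂ (proj₂ (proj₂ (proj₂ good₀))))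

    A>0 : 0 < A
    A>0 = proj₁ (proj₂ (proj₂ (proj₂ (proj₂ (proj₂ good₀)))))

    C>0 : 0 < C
    C>0 = proj₁ (proj₂ (proj₂ (proj₂ (proj₂ (proj₂ (proj₂ good₀))))))

    A≡ : A ≡ k * C + r₀
    A≡ = good-a r₀ A C A-def C-def

    kA≡ : k * A ≡ C + g * r₀
    kA≡ = begin
        k * A                ≡⟨ cong (k *_) A≡ ⟩
        k * (k * C + r₀)     ≡⟨ expand k C r₀ ⟩
        (k * k) * C + k * r₀ ≡⟨ cong (λ t → t * C + k * r₀) (sym (m∸n+n≡m 1≤kk)) ⟩
        (d + 1) * C + k * r₀ ≡⟨ split d C k r₀ ⟩
        C + C * d + k * r₀   ≡⟨ cong (λ t → C + t + k * r₀) C-def ⟩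
        C + r₀ * (g ∸ k) + k * r₀ ≡⟨ collect C r₀ (g ∸ k) k ⟩
        C + r₀ * ((g ∸ k) + k) ≡⟨ cong (λ t → C + r₀ * t) (m∸n+n≡m (<⇒≤ k<g)) ⟩
        C + r₀ * g           ≡⟨ cong (C +_) (*-comm r₀ g) ⟩
        C + g * r₀           ∎
      where
      open ≡-Reasoning
      expand : ∀ k C r₀ → k * (k * C + r₀) ≡ (k * k) * C + k * r₀
      expand = solve-∀
      split : ∀ d C k r₀ → (d + 1) * C + k * r₀ ≡ C + C * d + k * r₀
      split = solve-∀
      collect : ∀ C r₀ G k → C + r₀ * G + k * r₀ ≡ C + r₀ * (G + k)
      collect = solve-∀

    -- Subtracting a multiple of r₀ from a good value leaves a good value (if positive):
    -- its smaller digit drops by the matching multiple of C.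
    remainder-good : ∀ r ρ q → GoodR g k r → r ≡ ρ + q * r₀ → 0 < ρ → GoodR g k ρ
    remainder-good r ρ q (_ , a , b , ha , hb , _ , _ , a<g) r≡ ρ>0 =
      good-intro ρ (b ∸ q * C) ρ>0 b'>0 hb' b'-bound
      where
      r₀b≡ : r₀ * b ≡ ρ * C + r₀ * (q * C)
      r₀b≡ = trans (sym (proportional r₀ C r b C-def hb))
                   (trans (cong (_* C) r≡) (distribute ρ q r₀ C))
        where
        distribute : ∀ ρ q r₀ C → (ρ + q * r₀) * C ≡ ρ * C + r₀ * (q * C)
        distribute = solve-∀
      r₀b'≡ : r₀ * (b ∸ q * C) ≡ ρ * C
      r₀b'≡ = trans (*-distribˡ-∸ r₀ b (q * C)) (trans (cong (_∸ r₀ * (q * C)) r₀b≡) (m+n∸n≡m (ρ * C) (r₀ * (q * C))))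
      hb' : (b ∸ q * C) * d ≡ ρ * (g ∸ k)
      hb' = *-cancelˡ-≡ ((b ∸ q * C) * d) (ρ * (g ∸ k)) r₀ (begin
          r₀ * ((b ∸ q * C) * d)  ≡⟨ sym (*-assoc r₀ (b ∸ q * C) d) ⟩
          (r₀ * (b ∸ q * C)) * d  ≡⟨ cong (_* d) r₀b'≡ ⟩
          (ρ * C) * d             ≡⟨ *-assoc ρ C d ⟩
          ρ * (C * d)             ≡⟨ cong (ρ *_) C-def ⟩
          ρ * (r₀ * (g ∸ k))      ≡⟨ swap ρ r₀ (g ∸ k) ⟩
          r₀ * (ρ * (g ∸ k))      ∎)
        where
        open ≡-Reasoning
        swap : ∀ ρ r₀ G → ρ * (r₀ * G) ≡ r₀ * (ρ * G)
        swap = solve-∀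
      b'>0 : 0 < b ∸ q * C
      b'>0 = n≢0⇒n>0 (λ b'≡0 → <⇒≢ (*-mono-< ρ>0 C>0) (sym (trans (sym r₀b'≡) (trans (cong (r₀ *_) b'≡0) (*-zeroʳ r₀)))))
      b'-bound : k * (b ∸ q * C) + ρ < g
      b'-bound = ≤-<-trans (+-mono-≤ (*-monoʳ-≤ k (m∸n≤m b (q * C))) (≤-trans (m≤m+n ρ (q * r₀)) (≤-reflexive (sym r≡))))
                           (subst (_< g) (good-a r a b ha hb) a<g)

    good-multiple : (∀ r → GoodR g k r → r₀ ≤ r) → ∀ r → GoodR g k r → ∃[ q ] (1 ≤ q × r ≡ q * r₀ × q * A < g)
    good-multiple least r good with r % r₀ | m≡m%n+[m/n]*n r r₀ | m%n<n r r₀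
    ... | suc ρ | r≡ | ρ<r₀ = ⊥-elim (<⇒≱ ρ<r₀ (least (suc ρ) (remainder-good r (suc ρ) (r / r₀) good r≡ (s≤s z≤n))))
    ... | zero  | r≡ | _ with good
    ...   | r>0 , a , b , ha , hb , _ , _ , a<g = q , 1≤q , r≡ , subst (_< g) a≡qA a<g
      where
      q : ℕ
      q = r / r₀
      b≡qC : b ≡ q * C
      b≡qC = *-cancelˡ-≡ b (q * C) r₀ (trans (sym (proportional r₀ C r b C-def hb)) (trans (cong (_* C) r≡) (swap q r₀ C)))
        where
        swap : ∀ q r₀ C → (q * r₀) * C ≡ r₀ * (q * C)
        swap = solve-∀
      a≡qA : a ≡ q * A
      a≡qA = begin
          a                    ≡⟨ good-a r a b ha hb ⟩
          k * b + r            ≡⟨ cong₂ (λ t u → k * t + u) b≡qC r≡ ⟩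
          k * (q * C) + q * r₀ ≡⟨ collect k q C r₀ ⟩
          q * (k * C + r₀)     ≡⟨ cong (q *_) (sym A≡) ⟩
          q * A                ∎
        where
        open ≡-Reasoning
        collect : ∀ k q C r₀ → k * (q * C) + q * r₀ ≡ q * (k * C + r₀)
        collect = solve-∀
      1≤q : 1 ≤ q
      1≤q with q
      ... | zero  = ⊥-elim (<⇒≱ r>0 (≤-reflexive r≡))
      ... | suc _ = s≤s z≤n

    open DigitIdentities g k r₀ A C A≡ kA≡ using (edge-carry-r)

    -- There are m − 1 good values, all of the form q r₀ with 1 ≤ q and q A < g.  If
    -- (m − 1) A ≥ g they would all lie among r₀, …, (m − 2) r₀; hence (m − 1) A < g.
    good-count-bound : (∀ r → GoodR g k r → r₀ ≤ r) → ∀ m → 2 ≤ m → HasCard (GoodR g k) (m ∸ 1) → (m ∸ 1) * A < g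
    good-count-bound least (suc zero) (s≤s ()) _
    good-count-bound least (suc (suc n)) _ (goods , #goods , unique , goods⇔) with suc n * A <? g
    ... | yes bound = bound
    ... | no ¬bound = ⊥-elim (<-irrefl refl (begin-strict
        n                 <⟨ n<1+n n ⟩
        suc n             ≡⟨ sym #goods ⟩
        length goods      ≤⟨ unique-⊆-length goods smaller unique goods⊆smaller ⟩
        length smaller    ≡⟨ trans (length-map _ (upTo n)) (length-upTo n) ⟩
        n                 ∎))
      where
      open ≤-Reasoning
      smaller : List ℕ
      smaller = map (λ i → suc i * r₀) (upTo n)
      goods⊆smaller : ∀ {r} → r ∈ goods → r ∈ smaller
      goods⊆smaller {r} r∈goods with good-multiple least r (Equivalence.from (goods⇔ r) r∈goods)
      ... | suc q , _ , refl , qA<g =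
        ∈-map⁺ (λ i → suc i * r₀) (∈-upTo⁺ (≤-pred (*-cancelʳ-< A (suc q) (suc n) (<-≤-trans qA<g (≮⇒≥ ¬bound)))))

    small-multiple : ∀ m → (m ∸ 1) * A < g → ∀ i → i < m → i * r₀ ≤ k ∸ 1
    small-multiple m mA<g i i<m = <⇒≤∸1 (*-cancelˡ-< g (i * r₀) k (begin-strict
        g * (i * r₀)         ≤⟨ m≤n+m (g * (i * r₀)) (i * C) ⟩
        i * C + g * (i * r₀) ≡⟨ collect i C g r₀ ⟩
        i * (C + g * r₀)     ≡⟨ cong (i *_) (sym kA≡) ⟩
        i * (k * A)          ≡⟨ swap i k A ⟩
        k * (i * A)          <⟨ *-monoʳ-< k {{>-nonZero (≤-trans (s≤s z≤n) 2≤k)}} iA<g ⟩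
        k * g                ≡⟨ *-comm k g ⟩
        g * k                ∎))
      where
      open ≤-Reasoning
      iA<g : i * A < g
      iA<g = ≤-<-trans (*-monoˡ-≤ A (<⇒≤∸1 i<m)) mA<g
      collect : ∀ i C g r₀ → i * C + g * (i * r₀) ≡ i * (C + g * r₀)
      collect = solve-∀
      swap : ∀ i k A → i * (k * A) ≡ k * (i * A)
      swap = solve-∀

    -- ... and the would-be edge labels i A + j C (i, j < m) are digits: the largest one,
    -- (m−1)(A + C), labels the loop at [(m−1) r₀, (m−1) r₀].
    digit-bound : ∀ m → 0 < g → 2 ≤ m → (m ∸ 1) * A < g → ∀ i j → i < m → j < m → i * A + j * C < g
    digit-bound m g>0 2≤m mA<g i j i<m j<m =
      ≤-<-trans (+-mono-≤ (*-monoˡ-≤ A (<⇒≤∸1 i<m)) (*-monoˡ-≤ C (<⇒≤∸1 j<m))) largest<g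
      where
      S : ℕ
      S = m ∸ 1
      largest<g : S * A + S * C < g
      largest<g = loop-digit-bound k (S * A + S * C) (S * r₀) g 2≤k
        (≤∸1⇒< (≤-trans (s≤s z≤n) 2≤k) (small-multiple m mA<g S (≤∸1⇒< (≤-trans (s≤s z≤n) 2≤m) ≤-refl))) g>0
        (trans (edge-carry-r S S) (cong (_+ g * (S * r₀)) (+-comm (S * C) (S * A))))

module Ladder (g k r₀ A C m : ℕ) (2≤k : 2 ≤ k) (A≡ : A ≡ k * C + r₀) (kA≡ : k * A ≡ C + g * r₀)
  (r₀>0 : 0 < r₀) (A>0 : 0 < A) (C>0 : 0 < C) (2≤m : 2 ≤ m)
  (small : ∀ i → i < m → i * r₀ ≤ k ∸ 1) (digit : ∀ i j → i < m → j < m → i * A + j * C < g) where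

  open DigitIdentities g k r₀ A C A≡ kA≡ public

  rung : ℕ → Node
  rung i = pair (i * r₀) (i * r₀)

  0<m : 0 < m
  0<m = ≤-trans (s≤s z≤n) 2≤m

  edge-between : ∀ i j → i < m → j < m → Edge g k (rung j) (i * C + j * A) (i * A + j * C) (rung i)
  edge-between i j i<m j<m = digit i j i<m j<m , subst (_< g) (+-comm (j * A) (i * C)) (digit j i j<m i<m) , tt ,
    i * r₀ , i * r₀ , edge-carry-s i j , small i i<m , edge-carry-r i j , refl

  positive-multiple : ∀ i x → 1 ≤ i → 0 < x → i * x ≢ 0
  positive-multiple i x 1≤i x>0 e = <⇒≱ (*-mono-≤ 1≤i x>0) (≤-reflexive e)

  -- The edge from the start node is the edge from [0,0] with its (now nonzero) label.
  edge-from-start : ∀ i → 1 ≤ i → i < m → Edge g k start (i * C) (i * A) (rung i)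
  edge-from-start i 1≤i i<m with edge-between i 0 i<m 0<m
  ... | a<g , c<g , _ , s' , r' , e₁ , s'≤ , e₂ , v≡ =
    subst (_< g) (+-identityʳ (i * A)) a<g , subst (_< g) (+-identityʳ (i * C)) c<g ,
    (positive-multiple i A 1≤i A>0 , positive-multiple i C 1≤i C>0) , s' , r' ,
    subst₂ (λ a c → a + 0 ≡ k * c + s') (+-identityʳ (i * A)) (+-identityʳ (i * C)) e₁ , s'≤ ,
    subst₂ (λ a c → k * a + 0 ≡ c + g * r') (+-identityʳ (i * A)) (+-identityʳ (i * C)) e₂ , v≡

  step-to-rung : ∀ i → 1 ≤ i → i < m → Step g k start (rung i)
  step-to-rung i 1≤i i<m = i * C , i * A , edge-from-start i 1≤i i<m

  -- Every rung is a node of the Young graph: reachable from the start node (rung 0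
  -- via rung 1) and itself an even pivot.
  rung-young : ∀ i → i < m → YNode g k (rung i)
  rung-young zero    _   = (step-to-rung 1 ≤-refl 2≤m ◅ (_ , _ , edge-between 0 1 0<m 2≤m) ◅ ε) , rung 0 , ε , inj₁ refl
  rung-young (suc i) i<m = (step-to-rung (suc i) (s≤s z≤n) i<m ◅ ε) , rung (suc i) , ε , inj₁ refl

  start-young : YNode g k start
  start-young = ε , rung 1 , (step-to-rung 1 ≤-refl 2≤m ◅ ε) , inj₁ refl

  label-from-origin : ∀ i c a → a + 0 ≡ k * c + i * r₀ → k * a + 0 ≡ c + g * (i * r₀) → c ≡ i * C × a ≡ i * A
  label-from-origin i c a e₁ e₂ with forced-label 2≤k 0 i a c e₁ e₂
  ... | a≡ , c≡ = trans c≡ (+-identityʳ (i * C)) , trans a≡ (+-identityʳ (i * A))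

  diagonal : ℕ → ℕ × ℕ
  diagonal i = i * r₀ , i * r₀

  rungs : List (ℕ × ℕ)
  rungs = map diagonal (upTo m)

  rungs-unique : Unique rungs
  rungs-unique = Unique.map⁺ (λ e → *-cancelʳ-≡ _ _ r₀ {{>-nonZero r₀>0}} (cong proj₁ e)) (Unique.upTo⁺ m)

  open DecMembership (Product.≡-dec _≟_ _≟_) using (_∈?_)

  young-rungs : IsCompleteYoung g k m → ∀ s r → YNode g k (pair s r) → ∃[ i ] (i < m × s ≡ i * r₀ × r ≡ i * r₀)
  young-rungs (_ , (nodes , #nodes , _ , nodes⇔) , _) s r young with (s , r) ∈? rungs
  ... | yes p with ∈-map⁻ diagonal p
  ...   | i , i∈ , sr≡ = i , ∈-upTo⁻ i∈ , cong proj₁ sr≡ , cong proj₂ sr≡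
  young-rungs (_ , (nodes , #nodes , _ , nodes⇔) , _) s r young | no ¬p =
    ⊥-elim (<-irrefl refl (begin-strict
      m                      <⟨ n<1+n m ⟩
      suc m                  ≡⟨ cong suc (sym (trans (length-map diagonal (upTo m)) (length-upTo m))) ⟩
      length ((s , r) ∷ rungs) ≤⟨ unique-⊆-length ((s , r) ∷ rungs) nodes (AllP.¬Any⇒All¬ rungs ¬p ∷ rungs-unique) ⊆nodes ⟩
      length nodes           ≡⟨ #nodes ⟩
      m                      ∎))
    where
    open ≤-Reasoning
    ⊆nodes : ∀ {x} → x ∈ (s , r) ∷ rungs → x ∈ nodes
    ⊆nodes (here refl) = Equivalence.to (nodes⇔ s r) young
    ⊆nodes (there q) with ∈-map⁻ diagonal q
    ... | i , i∈ , refl = Equivalence.to (nodes⇔ (i * r₀) (i * r₀)) (rung-young i (∈-upTo⁻ i∈))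

SmallPalindrome : ℕ → List ℕ → Set
SmallPalindrome m β = All (_< m) β × reverse β ≡ β × LeadingNonzero β

module Reading (g k r₀ A C m : ℕ) (2≤k : 2 ≤ k) (A≡ : A ≡ k * C + r₀) (kA≡ : k * A ≡ C + g * r₀)
  (r₀>0 : 0 < r₀) (A>0 : 0 < A) (C>0 : 0 < C) (2≤m : 2 ≤ m)
  (small : ∀ i → i < m → i * r₀ ≤ k ∸ 1) (digit : ∀ i j → i < m → j < m → i * A + j * C < g)
  (rungs-only : ∀ s r → YNode g k (pair s r) → ∃[ i ] (i < m × s ≡ i * r₀ × r ≡ i * r₀)) where

  open Ladder g k r₀ A C m 2≤k A≡ kA≡ r₀>0 A>0 C>0 2≤m small digit

  -- spread p β lists, least significant first, the digits of the product of (C, A)_g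
  -- with β = (…, b₁, b₀)_g preceded by a digit p:  b₀A + pC, b₁A + b₀C, …, b_last C.
  -- Since i A + j C < g for digits below m, no carries occur.
  spread : ℕ → List ℕ → List ℕ
  spread p []       = [ p * C ]
  spread p (b ∷ bs) = (b * A + p * C) ∷ spread b bs

  spread-init : ∀ p bs → ∃[ ys ] ∃[ w ] (spread p bs ≡ ys ++ [ w ])
  spread-init p []       = [] , p * C , refl
  spread-init p (b ∷ bs) with spread-init b bs
  ... | ys , w , e = (b * A + p * C) ∷ ys , w , cong ((b * A + p * C) ∷_) e

  spread-snoc : ∀ p bs ys w z → spread p bs ≡ ys ++ [ w ] → spread p (bs ++ [ z ]) ≡ ys ++ (w + z * A) ∷ [ z * C ]
  spread-snoc p []       ys       w z e with ∷ʳ-injective [] ys e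
  ... | refl , refl = cong (λ t → t ∷ [ z * C ]) (+-comm (z * A) (p * C))
  spread-snoc p (b ∷ []) []       w z ()
  spread-snoc p (b ∷ _ ∷ _) []    w z ()
  spread-snoc p (b ∷ bs) (y ∷ ys) w z e with ∷-injective e
  ... | refl , e' = cong ((b * A + p * C) ∷_) (spread-snoc b bs ys w z e')

  -- Window i ds: ds is the middle part of the digits of γβ for a palindrome β over
  -- digits < m, cut out just inside two occurrences of the digit i of β.
  Window : ℕ → List ℕ → Set
  Window i ds = ∃[ q ] (All (_< m) q × reverse (i ∷ q) ≡ i ∷ q × spread i q ≡ ds ++ [ i * C ])

  window-outer : ∀ i j x mid y → i < m → j < m → Window j mid → x ≡ j * A + i * C → y ≡ j * C + i * A →
    Window i (x ∷ mid ++ [ y ])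
  window-outer i j x mid y i<m j<m (q , q<m , pal , spread≡) refl refl =
    j ∷ q ++ [ i ] , j<m ∷ AllP.++⁺ q<m (i<m ∷ []) ,
    trans (reverse-outer i (j ∷ q) i) (cong (λ t → i ∷ t ++ [ i ]) pal) ,
    cong ((j * A + i * C) ∷_) (trans (spread-snoc j q mid (j * C) i spread≡) (sym (++-assoc mid [ j * C + i * A ] [ i * C ])))

  -- Carries s r ds: ds, read from both ends, is a reverse multiple "with incoming
  -- carries" s (at the top) and r (at the bottom); Carries 0 0 ds says k·ds = reverse ds.
  Carries : ℕ → ℕ → List ℕ → Set
  Carries s r ds = k * val g ds + r ≡ val g (reverse ds) + s * g ^ length ds

  carries-outer : ∀ s r x mid y → Carries s r (x ∷ mid ++ [ y ]) →
    k * (x + g * (val g mid + g ^ length mid * y)) + r ≡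
      (y + g * (val g (reverse mid) + g ^ length mid * x)) + s * (g * (g * g ^ length mid))
  carries-outer s r x mid y H = begin
      k * (x + g * (val g mid + g ^ length mid * y)) + r
        ≡⟨ cong (λ t → k * (x + g * t) + r) (sym (val-snoc g mid y)) ⟩
      k * val g (x ∷ mid ++ [ y ]) + r
        ≡⟨ H ⟩
      val g (reverse (x ∷ mid ++ [ y ])) + s * g ^ length (x ∷ mid ++ [ y ])
        ≡⟨ cong₂ (λ t n → val g t + s * g ^ n) (reverse-outer x mid y) (length-outer x mid y) ⟩
      (y + g * val g (reverse mid ++ [ x ])) + s * (g * (g * g ^ length mid))
        ≡⟨ cong (λ t → (y + g * t) + s * (g * (g * g ^ length mid)))
                (trans (val-snoc g (reverse mid) x) (cong (λ n → val g (reverse mid) + g ^ n * x) (length-reverse mid))) ⟩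
      (y + g * (val g (reverse mid) + g ^ length mid * x)) + s * (g * (g * g ^ length mid)) ∎
    where open ≡-Reasoning

  -- Removing the outer digits x … y of a list with carries (s, r) traverses an edge
  -- labelled (y, x) from [s, r] to the carries (s', r') of the middle.
  record Peeled (s r x : ℕ) (mid : List ℕ) (y : ℕ) : Set where
    field
      s' r'  : ℕ
      low    : x + s * g ≡ k * y + s'
      s'≤    : s' ≤ k ∸ 1
      high   : k * x + r ≡ y + g * r'
      r'≤    : r' ≤ k ∸ 1
      middle : Carries s' r' mid

  peel-outer : ∀ s r x mid y → x < g → y < g → All (_< g) mid → r ≤ k ∸ 1 →
    Carries s r (x ∷ mid ++ [ y ]) → Peeled s r x mid y
  peel-outer s r x mid y x<g y<g mid<g r≤ H =
    peeled (carry-step g k s r x y (g ^ length mid) (val g mid) (val g (reverse mid)) x<g y<g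
             (≤∸1⇒< (≤-trans (s≤s z≤n) 2≤k) r≤) (val-bound g mid mid<g) (val-reverse-bound g mid mid<g)
             (carries-outer s r x mid y H))
    where
    peeled : ∃[ s' ] ∃[ r' ] (x + s * g ≡ k * y + s' × s' < k × k * x + r ≡ y + g * r' × r' < k × Carries s' r' mid) →
      Peeled s r x mid y
    peeled (s' , r' , low , s'<k , high , r'<k , middle) = record
      { s' = s' ; r' = r' ; low = low ; s'≤ = <⇒≤∸1 s'<k ; high = high ; r'≤ = <⇒≤∸1 r'<k ; middle = middle }

  peeled-step : ∀ u x mid y → x < g → y < g → StartCond u y x → (p : Peeled (sOf u) (rOf u) x mid y) →
    Step g k u (pair (Peeled.s' p) (Peeled.r' p))
  peeled-step u x mid y x<g y<g cond p = y , x , x<g , y<g , cond , s' , r' , low , s'≤ , high , refl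
    where open Peeled p

  outer-digits<g : ∀ x mid y → All (_< g) (x ∷ mid ++ [ y ]) → x < g × All (_< g) mid × y < g
  outer-digits<g x mid y (x<g ∷ rest) = x<g , AllP.++⁻ˡ mid rest , single< (AllP.++⁻ʳ mid rest)
    where
    single< : All (_< g) [ y ] → y < g
    single< (y<g ∷ []) = y<g

  PivotReachable : Node → Set
  PivotReachable u = ∃[ w ] (Path g k u w × Pivot g k w)

  reachable-back : ∀ {u v} → Step g k u v → PivotReachable v → PivotReachable u
  reachable-back step (w , path , pivot) = w , step ◅ path , pivot

  walk-single : ∀ s r x → x < g → r ≤ k ∸ 1 → Carries s r [ x ] →
    PivotReachable (pair s r) × (∀ i → i < m → s ≡ i * r₀ → r ≡ i * r₀ → Window i [ x ])
  walk-single s r x x<g r≤ H = pivot , window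
    where
    kx+r≡ : k * x + r ≡ x + s * g
    kx+r≡ = trans (cong (λ t → k * t + r) (sym (val-single g x))) (trans H (cong₂ _+_ (val-single g x) (cong (s *_) (*-identityʳ g))))
    kx+r≡' : k * x + r ≡ x + g * s
    kx+r≡' = trans kx+r≡ (cong (x +_) (*-comm s g))
    pivot : PivotReachable (pair s r)
    pivot with s ≟ r
    ... | yes s≡r = pair s r , ε , inj₁ s≡r
    ... | no  s≢r = pair s r , ε , inj₂ (inj₂ (s≢r , x , x , x<g , x<g , tt , r , s , sym kx+r≡ , r≤ , kx+r≡' , refl))
    window : ∀ i → i < m → s ≡ i * r₀ → r ≡ i * r₀ → Window i [ x ]
    window i i<m refl refl = [ i ] , i<m ∷ [] , refl ,
      cong (λ t → t ∷ [ i * C ]) (sym (proj₁ (forced-label 2≤k i i x x (sym kx+r≡) kx+r≡')))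

  -- A list ds with carries (s, r) at a node [s, r] of H(g, k) is read
  -- from both ends; the nodes visited stay in H, the walk ends at a pivot, and since
  -- every visited node is a Young node, hence a rung, all digits are forced: if [s, r]
  -- is rung i then ds is a window at i.
  walk : ∀ n s r ds → length ds ≤ n → InH g k (pair s r) → All (_< g) ds → r ≤ k ∸ 1 → Carries s r ds →
    PivotReachable (pair s r) × (∀ i → i < m → s ≡ i * r₀ → r ≡ i * r₀ → Window i ds)
  walk n s r ds len h ds<g r≤ H with ends ds
  walk n s r ds len h ds<g r≤ H | none =
    (pair s r , ε , inj₁ (sym r≡s)) , λ _ _ _ _ → [] , [] , refl , refl
    where
    r≡s : r ≡ s
    r≡s = trans (sym (cong (_+ r) (*-zeroʳ k))) (trans H (*-identityʳ s))
  walk n s r ds len h (x<g ∷ []) r≤ H | single x = walk-single s r x x<g r≤ H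
  walk zero s r ds () h ds<g r≤ H | outer x mid y
  walk (suc n) s r ds (s≤s len) h ds<g r≤ H | outer x mid y with outer-digits<g x mid y ds<g
  ... | x<g , mid<g , y<g = reachable-back step (proj₁ inner) , window
    where
    p : Peeled s r x mid y
    p = peel-outer s r x mid y x<g y<g mid<g r≤ H
    open Peeled p
    step : Step g k (pair s r) (pair s' r')
    step = peeled-step (pair s r) x mid y x<g y<g tt p
    h' : InH g k (pair s' r')
    h' = h ◅◅ (step ◅ ε)
    len' : length mid ≤ n
    len' = ≤-trans (m≤m+n (length mid) 1) (≤-trans (≤-reflexive (sym (length-++ mid))) len)
    inner : PivotReachable (pair s' r') × (∀ j → j < m → s' ≡ j * r₀ → r' ≡ j * r₀ → Window j mid)
    inner = walk n s' r' mid len' h' mid<g r'≤ middle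
    window : ∀ i → i < m → s ≡ i * r₀ → r ≡ i * r₀ → Window i (x ∷ mid ++ [ y ])
    window i i<m s≡ r≡ = widen (rungs-only s' r' (h' , proj₁ inner))
      where
      widen : ∃[ j ] (j < m × s' ≡ j * r₀ × r' ≡ j * r₀) → Window i (x ∷ mid ++ [ y ])
      widen (j , j<m , s'≡ , r'≡) = window-outer i j x mid y i<m j<m (proj₂ inner j j<m s'≡ r'≡) (proj₁ label) (proj₂ label)
        where
        label : x ≡ j * A + i * C × y ≡ j * C + i * A
        label = forced-label 2≤k i j x y
          (trans (cong (λ t → x + t * g) (sym s≡)) (trans low (cong (k * y +_) s'≡)))
          (trans (cong (k * x +_) (sym r≡)) (trans high (cong (λ t → y + g * t) r'≡)))

  -- A reverse multiple does not end in the digit 0: otherwise k N ≥ N would reach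
  -- g^(n−1) while the reversal, whose leading digit is 0, stays below it.
  last-digit-nonzero : ∀ mid y → 0 < y → y < g → All (_< g) mid → Carries 0 0 (0 ∷ mid ++ [ y ]) → ⊥
  last-digit-nonzero mid y y>0 y<g mid<g H = <-irrefl refl (begin-strict
      g * G                       ≡⟨ cong (g *_) (sym (*-identityʳ G)) ⟩
      g * (G * 1)                 ≤⟨ *-monoʳ-≤ g (*-monoʳ-≤ G y>0) ⟩
      g * (G * y)                 ≤⟨ *-monoʳ-≤ g (m≤n+m (G * y) M) ⟩
      g * (M + G * y)             ≡⟨ sym (*-identityˡ _) ⟩
      1 * (g * (M + G * y))       ≤⟨ *-monoˡ-≤ (g * (M + G * y)) (≤-trans (s≤s z≤n) 2≤k) ⟩
      k * (g * (M + G * y))       ≡⟨ sym (+-identityʳ _) ⟩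
      k * (0 + g * (M + G * y)) + 0 ≡⟨ carries-outer 0 0 0 mid y H ⟩
      (y + g * (M' + G * 0)) + 0  ≡⟨ drop-zeros y g M' G ⟩
      y + g * M'                  <⟨ +-monoˡ-< (g * M') y<g ⟩
      g + g * M'                  ≡⟨ sym (*-suc g M') ⟩
      g * suc M'                  ≤⟨ *-monoʳ-≤ g (val-reverse-bound g mid mid<g) ⟩
      g * G                       ∎)
    where
    open ≤-Reasoning
    G M M' : ℕ
    G = g ^ length mid
    M = val g mid
    M' = val g (reverse mid)
    drop-zeros : ∀ y g M' G → (y + g * (M' + G * 0)) + 0 ≡ y + g * M'
    drop-zeros = solve-∀

  spread-leading : ∀ β ds y → y ≢ 0 → spread 0 β ≡ ds ++ [ y ] → LeadingNonzero β
  spread-leading β ds y y≢0 e with initLast β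
  ... | [] = ⊥-elim (y≢0 (sym (proj₂ (∷ʳ-injective [] ds e))))
  ... | β' ∷ʳ′ b with spread-init 0 β'
  ...   | ys , w , spread≡ = β' , b , refl , λ b≡0 → y≢0 (trans y≡bC (cong (_* C) b≡0))
    where
    y≡bC : y ≡ b * C
    y≡bC = sym (proj₂ (∷ʳ-injective (ys ++ [ w + b * A ]) ds
             (trans (++-assoc ys [ w + b * A ] [ b * C ]) (trans (sym (spread-snoc 0 β' ys w b spread≡)) e))))

  window-at-origin : ∀ ds y → y ≢ 0 → Window 0 (ds ++ [ y ]) → ∃[ β ] (SmallPalindrome m β × ds ++ [ y ] ≡ spread 0 β)
  window-at-origin ds y y≢0 (q , q<m , pal , spread≡) with initLast q
  ... | [] = ⊥-elim (snoc-nonempty ds y (proj₁ (∷ʳ-injective [] (ds ++ [ y ]) spread≡)))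
  ... | β ∷ʳ′ e with palindrome-outer 0 β e pal
  ...   | refl , β-pal with spread-init 0 β
  ...     | ys , w , spreadβ≡ = β , (AllP.++⁻ˡ β q<m , β-pal , spread-leading β ds y y≢0 (sym digits≡)) , digits≡
    where
    digits≡ : ds ++ [ y ] ≡ spread 0 β
    digits≡ = trans (sym (proj₁ (∷ʳ-injective (ys ++ [ w + 0 ]) (ds ++ [ y ])
                (trans (++-assoc ys [ w + 0 ] [ 0 ]) (trans (sym (spread-snoc 0 β ys w 0 spreadβ≡)) spread≡)))))
              (trans (cong (λ t → ys ++ [ t ]) (+-identityʳ w)) (sym spreadβ≡))

  -- Leaving the start node along the outer digits x … y of a reverse multiple: the
  -- walk through the middle shows that the edge ends at a rung j, which forces x and
  -- y, and the whole digit list is a window at rung 0.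
  shape-outer : ∀ x mid y → x < g × All (_< g) mid × y < g → y ≢ 0 → Carries 0 0 (x ∷ mid ++ [ y ]) →
    ∃[ β ] (SmallPalindrome m β × x ∷ mid ++ [ y ] ≡ spread 0 β)
  shape-outer x mid y (x<g , mid<g , y<g) y≢0 H =
    window-at-origin (x ∷ mid) y y≢0 (widen (rungs-only s' r' (h' , proj₁ inner)))
    where
    x≢0 : x ≢ 0
    x≢0 x≡0 = last-digit-nonzero mid y (n≢0⇒n>0 y≢0) y<g mid<g (subst (λ t → Carries 0 0 (t ∷ mid ++ [ y ])) x≡0 H)
    p : Peeled 0 0 x mid y
    p = peel-outer 0 0 x mid y x<g y<g mid<g z≤n H
    open Peeled p
    h' : InH g k (pair s' r')
    h' = peeled-step start x mid y x<g y<g (x≢0 , y≢0) p ◅ ε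
    inner : PivotReachable (pair s' r') × (∀ j → j < m → s' ≡ j * r₀ → r' ≡ j * r₀ → Window j mid)
    inner = walk (length mid) s' r' mid ≤-refl h' mid<g r'≤ middle
    widen : ∃[ j ] (j < m × s' ≡ j * r₀ × r' ≡ j * r₀) → Window 0 (x ∷ mid ++ [ y ])
    widen (j , j<m , s'≡ , r'≡) = window-outer 0 j x mid y 0<m j<m (proj₂ inner j j<m s'≡ r'≡) (proj₁ label) (proj₂ label)
      where
      label : x ≡ j * A + 0 * C × y ≡ j * C + 0 * A
      label = forced-label 2≤k 0 j x y (trans low (cong (k * y +_) s'≡)) (trans high (cong (λ t → y + g * t) r'≡))

  -- A single digit x would satisfy
  -- k x = x, which forces x = 0.
  reverse-multiple-shape : ∀ ds → All (_< g) ds → LeadingNonzero ds → Carries 0 0 ds →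
    ∃[ β ] (SmallPalindrome m β × ds ≡ spread 0 β)
  reverse-multiple-shape ds ds<g lead H with ends ds
  ... | none          = ⊥-elim (leading-nonempty lead)
  ... | single x      = ⊥-elim (leading-last [] x lead (scaling-fixpoint x 2≤k kx≡x))
    where
    kx≡x : k * x ≡ x
    kx≡x = begin
        k * x                ≡⟨ cong (k *_) (sym (val-single g x)) ⟩
        k * val g [ x ]      ≡⟨ sym (+-identityʳ _) ⟩
        k * val g [ x ] + 0  ≡⟨ H ⟩
        val g [ x ] + 0      ≡⟨ +-identityʳ _ ⟩
        val g [ x ]          ≡⟨ val-single g x ⟩
        x                    ∎
      where open ≡-Reasoning
  ... | outer x mid y = shape-outer x mid y (outer-digits<g x mid y ds<g) (leading-last (x ∷ mid) y lead) H

  spread-digits : ∀ p bs → p < m → All (_< m) bs → All (_< g) (spread p bs)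
  spread-digits p []       p<m []           = digit 0 p 0<m p<m ∷ []
  spread-digits p (b ∷ bs) p<m (b<m ∷ bs<m) = digit b p b<m p<m ∷ spread-digits b bs b<m bs<m

  length-spread : ∀ p bs → length (spread p bs) ≡ suc (length bs)
  length-spread p []       = refl
  length-spread p (b ∷ bs) = cong suc (length-spread b bs)

  val-spread : ∀ p bs → val g (spread p bs) ≡ p * C + (A + g * C) * val g bs
  val-spread p []       = cong (p * C +_) (trans (*-zeroʳ g) (sym (*-zeroʳ (A + g * C))))
  val-spread p (b ∷ bs) = trans (cong (λ t → (b * A + p * C) + g * t) (val-spread b bs)) (regroup b A p C g (val g bs))
    where
    regroup : ∀ b A p C g V → (b * A + p * C) + g * (b * C + (A + g * C) * V) ≡ p * C + (A + g * C) * (b + g * V)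
    regroup = solve-∀

  val-reverse-spread : ∀ cs → val g (reverse (spread 0 (reverse cs))) ≡ (C + g * A) * val g cs
  val-reverse-spread [] = trans (*-zeroʳ g) (sym (*-zeroʳ (C + g * A)))
  val-reverse-spread (c ∷ cs) with spread-init 0 (reverse cs)
  ... | ys , w , spread≡ = begin
      val g (reverse (spread 0 (reverse (c ∷ cs))))     ≡⟨ cong (λ t → val g (reverse (spread 0 t))) (unfold-reverse c cs) ⟩
      val g (reverse (spread 0 (reverse cs ++ [ c ])))  ≡⟨ cong (λ t → val g (reverse t)) (spread-snoc 0 (reverse cs) ys w c spread≡) ⟩
      val g (reverse (ys ++ (w + c * A) ∷ [ c * C ]))   ≡⟨ cong (val g) (reverse-++ ys ((w + c * A) ∷ [ c * C ])) ⟩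
      c * C + g * ((w + c * A) + g * val g (reverse ys)) ≡⟨ regroup c C g w A (val g (reverse ys)) ⟩
      (c * C + g * (c * A)) + g * (w + g * val g (reverse ys)) ≡⟨ cong (λ t → (c * C + g * (c * A)) + g * t) shorter ⟩
      (c * C + g * (c * A)) + g * ((C + g * A) * val g cs) ≡⟨ collect c C g A (val g cs) ⟩
      (C + g * A) * (c + g * val g cs)                   ∎
    where
    open ≡-Reasoning
    regroup : ∀ c C g w A V → c * C + g * ((w + c * A) + g * V) ≡ (c * C + g * (c * A)) + g * (w + g * V)
    regroup = solve-∀
    collect : ∀ c C g A V → (c * C + g * (c * A)) + g * ((C + g * A) * V) ≡ (C + g * A) * (c + g * V)
    collect = solve-∀
    shorter : w + g * val g (reverse ys) ≡ (C + g * A) * val g cs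
    shorter = trans (sym (cong (val g) (reverse-++ ys [ w ])))
                    (trans (cong (λ t → val g (reverse t)) (sym spread≡)) (val-reverse-spread cs))

  spread-leading⁺ : ∀ β' b → b ≢ 0 → LeadingNonzero (spread 0 (β' ++ [ b ]))
  spread-leading⁺ β' b b≢0 with spread-init 0 β'
  ... | ys , w , spread≡ = ys ++ [ w + b * A ] , b * C ,
        trans (spread-snoc 0 β' ys w b spread≡) (sym (++-assoc ys [ w + b * A ] [ b * C ])) ,
        positive-multiple b C (n≢0⇒n>0 b≢0) C>0

  γ : ℕ
  γ = C * g + A

  -- Every γβ with β a small palindrome is a reverse multiple, one digit longer than β:
  -- k (A + gC) = C + gA and β = reverse β.
  palindrome-reverse-multiple : ∀ β N → SmallPalindrome m β → N ≡ γ * val g β → RevMultLen g k (suc (length β)) N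
  palindrome-reverse-multiple β N (β<m , β-pal , (β' , b , β≡ , b≢0)) N≡ =
    spread 0 β , length-spread 0 β , spread-digits 0 β 0<m β<m ,
    subst (λ t → LeadingNonzero (spread 0 t)) (sym β≡) (spread-leading⁺ β' b b≢0) , N≡val , kN≡
    where
    N≡val : N ≡ val g (spread 0 β)
    N≡val = trans N≡ (trans (cong (_* val g β) (trans (cong (_+ A) (*-comm C g)) (+-comm (g * C) A))) (sym (val-spread 0 β)))
    kN≡ : k * N ≡ val g (reverse (spread 0 β))
    kN≡ = begin
        k * N                                    ≡⟨ cong (k *_) (trans N≡val (val-spread 0 β)) ⟩
        k * ((A + g * C) * val g β)              ≡⟨ k-reverses-γ (val g β) ⟩
        (C + g * A) * val g β                    ≡⟨ sym (val-reverse-spread β) ⟩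
        val g (reverse (spread 0 (reverse β)))   ≡⟨ cong (λ t → val g (reverse (spread 0 t))) β-pal ⟩
        val g (reverse (spread 0 β))             ∎
      where open ≡-Reasoning

  reverse-multiple-palindrome : ∀ t N → RevMultLen g k t N →
    ∃[ β ] (SmallPalindrome m β × suc (length β) ≡ t × N ≡ γ * val g β)
  reverse-multiple-palindrome t N (ds , len , ds<g , lead , N≡ , kN≡) with
    reverse-multiple-shape ds ds<g lead (trans (+-identityʳ _) (trans (trans (cong (k *_) (sym N≡)) kN≡) (sym (+-identityʳ _))))
  ... | β , small-β , ds≡ = β , small-β , trans (sym (length-spread 0 β)) (trans (cong length (sym ds≡)) len) ,
        trans N≡ (trans (cong (val g) ds≡) (trans (val-spread 0 β) (cong (_* val g β) (trans (+-comm A (g * C)) (cong (_+ A) (*-comm g C))))))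

-- wrap e β = e β e: every palindrome of length n + 2 arises uniquely this way.
wrap : ℕ → List ℕ → List ℕ
wrap e β = e ∷ β ++ [ e ]

wrap-injective : ∀ {e e' β β'} → wrap e β ≡ wrap e' β' → e ≡ e' × β ≡ β'
wrap-injective {β = β} {β'} e with refl , e' ← ∷-injective e = refl , proj₁ (∷ʳ-injective β β' e')

[-]-injective : ∀ {x y : ℕ} → [ x ] ≡ [ y ] → x ≡ y
[-]-injective refl = refl

module PalindromeCount (m : ℕ) where

  palindromes : ℕ → List (List ℕ)
  palindromes zero          = [ [] ]
  palindromes (suc zero)    = map [_] (upTo m)
  palindromes (suc (suc n)) = cartesianProductWith wrap (upTo m) (palindromes n)

  nonzero-digits : List ℕ
  nonzero-digits = map suc (upTo (m ∸ 1))

  small-palindromes : ℕ → List (List ℕ)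
  small-palindromes zero          = []
  small-palindromes (suc zero)    = map [_] nonzero-digits
  small-palindromes (suc (suc n)) = cartesianProductWith wrap nonzero-digits (palindromes n)

  palindromes-unique : ∀ n → Unique (palindromes n)
  palindromes-unique zero          = [] ∷ []
  palindromes-unique (suc zero)    = Unique.map⁺ [-]-injective (Unique.upTo⁺ m)
  palindromes-unique (suc (suc n)) =
    Unique.cartesianProductWith⁺ wrap wrap-injective (Unique.upTo⁺ m) (palindromes-unique n)

  nonzero-digits-unique : Unique nonzero-digits
  nonzero-digits-unique = Unique.map⁺ suc-injective (Unique.upTo⁺ (m ∸ 1))

  small-palindromes-unique : ∀ n → Unique (small-palindromes n)
  small-palindromes-unique zero          = []
  small-palindromes-unique (suc zero)    = Unique.map⁺ [-]-injective nonzero-digits-unique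
  small-palindromes-unique (suc (suc n)) =
    Unique.cartesianProductWith⁺ wrap wrap-injective nonzero-digits-unique (palindromes-unique n)

  ∈-nonzero-digits⁻ : ∀ {e} → e ∈ nonzero-digits → e ≢ 0 × e < m
  ∈-nonzero-digits⁻ p with ∈-map⁻ suc p
  ... | e' , q , refl = (λ ()) , shift (∈-upTo⁻ q)
    where
    shift : ∀ {e' m} → e' < m ∸ 1 → suc e' < m
    shift {m = suc m} e'<m = s≤s e'<m

  ∈-nonzero-digits⁺ : ∀ {e} → e ≢ 0 → e < m → e ∈ nonzero-digits
  ∈-nonzero-digits⁺ {zero}  e≢0 _           = ⊥-elim (e≢0 refl)
  ∈-nonzero-digits⁺ {suc e} _   (s≤s e<m-1) = ∈-map⁺ suc (∈-upTo⁺ e<m-1)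

  Palindrome : ℕ → List ℕ → Set
  Palindrome n β = All (_< m) β × reverse β ≡ β × length β ≡ n

  wrap-palindrome : ∀ n e β → e < m → Palindrome n β → Palindrome (suc (suc n)) (wrap e β)
  wrap-palindrome n e β e<m (β<m , β-pal , len) =
    (e<m ∷ AllP.++⁺ β<m (e<m ∷ [])) ,
    trans (reverse-outer e β e) (cong (λ t → e ∷ t ++ [ e ]) β-pal) ,
    trans (length-outer e β e) (cong (λ t → suc (suc t)) len)

  ∈-palindromes⁻ : ∀ n β → β ∈ palindromes n → Palindrome n β
  ∈-palindromes⁻ zero          β (here refl) = [] , refl , refl
  ∈-palindromes⁻ (suc zero)    β p with ∈-map⁻ [_] p
  ... | e , q , refl = (∈-upTo⁻ q ∷ []) , refl , refl
  ∈-palindromes⁻ (suc (suc n)) β p with ∈-cartesianProductWith⁻ wrap (upTo m) (palindromes n) p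
  ... | e , β' , e∈ , β'∈ , refl = wrap-palindrome n e β' (∈-upTo⁻ e∈) (∈-palindromes⁻ n β' β'∈)

  ∈-palindromes⁺ : ∀ n β → Palindrome n β → β ∈ palindromes n
  ∈-palindromes⁺ n β (β<m , β-pal , len) with ends β
  ∈-palindromes⁺ zero       β (β<m , β-pal , refl) | none = here refl
  ∈-palindromes⁺ (suc zero) β (e<m ∷ [] , β-pal , refl) | single e = ∈-map⁺ [_] (∈-upTo⁺ e<m)
  ∈-palindromes⁺ n β (β<m , β-pal , len) | outer x mid y with palindrome-outer x mid y β-pal
  ∈-palindromes⁺ (suc zero) β (_ , _ , len) | outer x mid y | refl , _ = ⊥-elim (outer-length≢1 x mid x len)
  ∈-palindromes⁺ (suc (suc n)) β (x<m ∷ rest<m , β-pal , len) | outer x mid y | refl , mid-pal =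
    ∈-cartesianProductWith⁺ wrap (∈-upTo⁺ x<m)
      (∈-palindromes⁺ n mid (AllP.++⁻ˡ mid rest<m , mid-pal , suc-injective (suc-injective (trans (sym (length-outer x mid x)) len))))

  leading-wrap : ∀ e β → LeadingNonzero (wrap e β) → e ≢ 0
  leading-wrap e β = leading-last (e ∷ β) e

  ∈-small-palindromes⁻ : ∀ n β → β ∈ small-palindromes n → SmallPalindrome m β × length β ≡ n
  ∈-small-palindromes⁻ (suc zero) β p with ∈-map⁻ [_] p
  ... | e , e∈ , refl with ∈-nonzero-digits⁻ e∈
  ...   | e≢0 , e<m = ((e<m ∷ []) , refl , ([] , e , refl , e≢0)) , refl
  ∈-small-palindromes⁻ (suc (suc n)) β p with ∈-cartesianProductWith⁻ wrap nonzero-digits (palindromes n) p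
  ... | e , β' , e∈ , β'∈ , refl with ∈-nonzero-digits⁻ e∈
  ...   | e≢0 , e<m with wrap-palindrome n e β' e<m (∈-palindromes⁻ n β' β'∈)
  ...     | all<m , pal , len = (all<m , pal , (e ∷ β' , e , refl , e≢0)) , len

  ∈-small-palindromes⁺ : ∀ n β → SmallPalindrome m β → length β ≡ n → β ∈ small-palindromes n
  ∈-small-palindromes⁺ n β (β<m , β-pal , lead) len with ends β
  ... | none = ⊥-elim (leading-nonempty lead)
  ∈-small-palindromes⁺ (suc zero) β (e<m ∷ [] , β-pal , lead) refl | single e =
    ∈-map⁺ [_] (∈-nonzero-digits⁺ (leading-last [] e lead) e<m)
  ∈-small-palindromes⁺ n β (β<m , β-pal , lead) len | outer x mid y with palindrome-outer x mid y β-pal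
  ∈-small-palindromes⁺ (suc zero) β _ len | outer x mid y | refl , _ = ⊥-elim (outer-length≢1 x mid x len)
  ∈-small-palindromes⁺ (suc (suc n)) β (x<m ∷ rest<m , β-pal , lead) len | outer x mid y | refl , mid-pal =
    ∈-cartesianProductWith⁺ wrap (∈-nonzero-digits⁺ (leading-wrap x mid lead) x<m)
      (∈-palindromes⁺ n mid (AllP.++⁻ˡ mid rest<m , mid-pal , suc-injective (suc-injective (trans (sym (length-outer x mid x)) len))))

  length-nonzero-digits : length nonzero-digits ≡ m ∸ 1
  length-nonzero-digits = trans (length-map suc (upTo (m ∸ 1))) (length-upTo (m ∸ 1))

  2j+2≡ : ∀ j → 2 * suc j ≡ suc (suc (2 * j))
  2j+2≡ j = *-suc 2 j

  length-palindromes-even : ∀ j → length (palindromes (2 * j)) ≡ m ^ j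
  length-palindromes-even zero    = refl
  length-palindromes-even (suc j) = trans (cong (λ n → length (palindromes n)) (2j+2≡ j))
    (trans (length-cartesianProductWith wrap (upTo m) (palindromes (2 * j)))
           (cong₂ _*_ (length-upTo m) (length-palindromes-even j)))

  length-palindromes-odd : ∀ j → length (palindromes (2 * j + 1)) ≡ m ^ suc j
  length-palindromes-odd zero    = trans (length-map [_] (upTo m)) (trans (length-upTo m) (sym (*-identityʳ m)))
  length-palindromes-odd (suc j) = trans (cong (λ n → length (palindromes (n + 1))) (2j+2≡ j))
    (trans (length-cartesianProductWith wrap (upTo m) (palindromes (2 * j + 1)))
           (cong₂ _*_ (length-upTo m) (length-palindromes-odd j)))

  length-small-odd : ∀ j → length (small-palindromes (2 * j + 1)) ≡ (m ∸ 1) * m ^ j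
  length-small-odd zero    = trans (length-map [_] nonzero-digits) (trans length-nonzero-digits (sym (*-identityʳ (m ∸ 1))))
  length-small-odd (suc j) = trans (cong (λ n → length (small-palindromes (n + 1))) (2j+2≡ j))
    (trans (length-cartesianProductWith wrap nonzero-digits (palindromes (2 * j + 1)))
           (cong₂ _*_ length-nonzero-digits (length-palindromes-odd j)))

  length-small-even : ∀ j → length (small-palindromes (2 * j + 2)) ≡ (m ∸ 1) * m ^ j
  length-small-even j = trans (cong (λ n → length (small-palindromes n)) (+-comm (2 * j) 2))
    (trans (length-cartesianProductWith wrap nonzero-digits (palindromes (2 * j)))
           (cong₂ _*_ length-nonzero-digits (length-palindromes-even j)))

module Theorem6 (g k m : ℕ) (3≤g : 3 ≤ g) (2≤k : 2 ≤ k) (k<g : k < g) (2≤m : 2 ≤ m)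
  (goods : HasCard (GoodR g k) (m ∸ 1)) (young : IsCompleteYoung g k m)
  (r₀ : ℕ) (good₀ : GoodR g k r₀) (least : ∀ r → GoodR g k r → r₀ ≤ r) where

  open GoodValues g k 2≤k k<g
  open RelativeTo r₀ good₀

  g>0 : 0 < g
  g>0 = ≤-trans (s≤s z≤n) 3≤g

  mA<g : (m ∸ 1) * A < g
  mA<g = good-count-bound least m 2≤m goods

  small : ∀ i → i < m → i * r₀ ≤ k ∸ 1
  small = small-multiple m mA<g

  digit : ∀ i j → i < m → j < m → i * A + j * C < g
  digit = digit-bound m g>0 2≤m mA<g

  open Ladder g k r₀ A C m 2≤k A≡ kA≡ r₀>0 A>0 C>0 2≤m small digit

  rungs-only : ∀ s r → YNode g k (pair s r) → ∃[ i ] (i < m × s ≡ i * r₀ × r ≡ i * r₀)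
  rungs-only = young-rungs young

  open Reading g k r₀ A C m 2≤k A≡ kA≡ r₀>0 A>0 C>0 2≤m small digit rungs-only
  open PalindromeCount m

  young-nodes : ∀ s r → YNode g k (pair s r) ⇔ (∃[ i ] (i < m × s ≡ i * r₀ × r ≡ i * r₀))
  young-nodes s r = mk⇔ (rungs-only s r) λ { (i , i<m , refl , refl) → rung-young i i<m }

  rung-label : ∀ i → Label g k (i * r₀) (i * C) (i * A)
  rung-label i = trans (*-assoc i C d) (trans (cong (i *_) C-def) (sym (*-assoc i r₀ (g ∸ k)))) ,
                 trans (*-assoc i A d) (trans (cong (i *_) A-def) (sym (*-assoc i r₀ (k * g ∸ 1))))

  label-unique : ∀ R c a c' a' → Label g k R c a → Label g k R c' a' → c ≡ c' × a ≡ a'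
  label-unique R c a c' a' (hc , ha) (hc' , ha') = *-cancelʳ-≡ c c' d (trans hc (sym hc')) , *-cancelʳ-≡ a a' d (trans ha (sym ha'))

  edges-from-origin : ∀ u i → sOf u ≡ 0 → rOf u ≡ 0 → YNode g k u → i < m → Edge g k u (i * C) (i * A) (rung i) →
    ∀ c a → YEdge g k u c a (rung i) ⇔ Label g k (i * r₀) c a
  edges-from-origin u i s≡0 r≡0 young-u i<m edge c a = mk⇔ to from
    where
    to : YEdge g k u c a (rung i) → Label g k (i * r₀) c a
    to (_ , _ , _ , _ , _ , s' , r' , e₁ , _ , e₂ , refl) =
      subst₂ (Label g k (i * r₀)) (sym (proj₁ forced)) (sym (proj₂ forced)) (rung-label i)
      where
      forced : c ≡ i * C × a ≡ i * A
      forced = label-from-origin i c a (subst (λ s → a + s * g ≡ k * c + i * r₀) s≡0 e₁)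
                                       (subst (λ r → k * a + r ≡ c + g * (i * r₀)) r≡0 e₂)
    from : Label g k (i * r₀) c a → YEdge g k u c a (rung i)
    from label = subst₂ (λ c a → YEdge g k u c a (rung i)) (sym (proj₁ same)) (sym (proj₂ same)) (young-u , rung-young i i<m , edge)
      where
      same : c ≡ i * C × a ≡ i * A
      same = label-unique (i * r₀) c a (i * C) (i * A) label (rung-label i)

  start-edges : ∀ i → 1 ≤ i → i < m → ∀ c a → YEdge g k start c a (rung i) ⇔ Label g k (i * r₀) c a
  start-edges i 1≤i i<m = edges-from-origin start i refl refl start-young i<m (edge-from-start i 1≤i i<m)

  origin-edges : ∀ i → i < m → ∀ c a → YEdge g k (pair 0 0) c a (rung i) ⇔ Label g k (i * r₀) c a
  origin-edges i i<m = edges-from-origin (pair 0 0) i refl refl (rung-young 0 0<m) i<m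
    (subst₂ (λ c a → Edge g k (pair 0 0) c a (rung i)) (+-identityʳ (i * C)) (+-identityʳ (i * A)) (edge-between i 0 i<m 0<m))

  digit<g : ∀ {i} → i < m → i < g
  digit<g {i} i<m = ≤-<-trans (≤-trans (≤-reflexive (sym (*-identityʳ i))) (*-monoʳ-≤ i A>0))
                              (subst (_< g) (+-identityʳ (i * A)) (digit i 0 i<m 0<m))

  count : ∀ ℓ → RevCount g k (suc ℓ) (length (small-palindromes ℓ))
  count ℓ = map times-γ (small-palindromes ℓ) , length-map times-γ (small-palindromes ℓ) ,
            unique-map times-γ (small-palindromes ℓ) (small-palindromes-unique ℓ) injective ,
            λ N → mk⇔ (listed N) (unlisted N)
    where
    times-γ : List ℕ → ℕ
    times-γ β = γ * val g β
    instance
      γ-nonZero : NonZero γ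
      γ-nonZero = >-nonZero (≤-trans A>0 (m≤n+m A (C * g)))
    injective : ∀ {β β'} → β ∈ small-palindromes ℓ → β' ∈ small-palindromes ℓ → times-γ β ≡ times-γ β' → β ≡ β'
    injective {β} {β'} β∈ β'∈ e =
      val-injective g β β' (trans (proj₂ sβ) (sym (proj₂ sβ'))) (All.map digit<g (proj₁ (proj₁ sβ))) (All.map digit<g (proj₁ (proj₁ sβ')))
        (*-cancelˡ-≡ (val g β) (val g β') γ e)
      where
      sβ  = ∈-small-palindromes⁻ ℓ β β∈
      sβ' = ∈-small-palindromes⁻ ℓ β' β'∈
    listed : ∀ N → RevMultLen g k (suc ℓ) N → N ∈ map times-γ (small-palindromes ℓ)
    listed N multiple = list (reverse-multiple-palindrome (suc ℓ) N multiple)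
      where
      list : ∃[ β ] (SmallPalindrome m β × suc (length β) ≡ suc ℓ × N ≡ γ * val g β) → N ∈ map times-γ (small-palindromes ℓ)
      list (β , small-β , len , N≡) =
        subst (_∈ map times-γ (small-palindromes ℓ)) (sym N≡) (∈-map⁺ times-γ (∈-small-palindromes⁺ ℓ β small-β (suc-injective len)))
    unlisted : ∀ N → N ∈ map times-γ (small-palindromes ℓ) → RevMultLen g k (suc ℓ) N
    unlisted N N∈ = unlist (∈-map⁻ times-γ N∈)
      where
      unlist : ∃[ β ] (β ∈ small-palindromes ℓ × N ≡ times-γ β) → RevMultLen g k (suc ℓ) N
      unlist (β , β∈ , N≡) = subst (λ n → RevMultLen g k (suc n) N) (proj₂ sβ) (palindrome-reverse-multiple β N (proj₁ sβ) N≡)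
        where
        sβ = ∈-small-palindromes⁻ ℓ β β∈

  count-zero : RevCount g k 0 0
  count-zero = [] , refl , [] , λ N → mk⇔ (λ { ([] , _ , _ , lead , _) → ⊥-elim (leading-nonempty lead) }) λ ()

  count-even : ∀ j → RevCount g k (2 * j + 2) ((m ∸ 1) * m ^ j)
  count-even j = subst₂ (RevCount g k) (sym (+-suc (2 * j) 1)) (length-small-odd j) (count (2 * j + 1))

  count-odd : ∀ j → RevCount g k (2 * j + 3) ((m ∸ 1) * m ^ j)
  count-odd j = subst₂ (RevCount g k) (sym (+-suc (2 * j) 2)) (length-small-even j) (count (2 * j + 2))

  multiple⇒product : ∀ N → RevMult g k N → ∃[ β ] (PalinDigits g m β × N ≡ γ * β)
  multiple⇒product N (t , multiple) = product (reverse-multiple-palindrome t N multiple)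
    where
    product : ∃[ β ] (SmallPalindrome m β × suc (length β) ≡ t × N ≡ γ * val g β) → ∃[ β ] (PalinDigits g m β × N ≡ γ * β)
    product (β , (β<m , β-pal , lead) , _ , N≡) = val g β , (β , All.map digit<g β<m , β<m , lead , β-pal , refl) , N≡

  product⇒multiple : ∀ N → ∃[ β ] (PalinDigits g m β × N ≡ γ * β) → RevMult g k N
  product⇒multiple N (_ , (β , _ , β<m , lead , β-pal , refl) , N≡) =
    suc (length β) , palindrome-reverse-multiple β N (β<m , β-pal , lead) N≡

  products : ∀ c a → Label g k r₀ c a → ∀ N → RevMult g k N ⇔ (∃[ β ] (PalinDigits g m β × N ≡ (c * g + a) * β))
  products c a label N = subst₂ (λ c a → RevMult g k N ⇔ (∃[ β ] (PalinDigits g m β × N ≡ (c * g + a) * β)))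
    (sym (proj₁ same)) (sym (proj₂ same)) (mk⇔ (multiple⇒product N) (product⇒multiple N))
    where
    same : c ≡ C × a ≡ A
    same = label-unique r₀ c a C A label (C-def , A-def)

-- Parts (i), (ii) (c₀ = c₁ = 0 and c_{2j+2} = c_{2j+3} = (m − 1) mʲ) and (iii).
theorem6 : (g k m : ℕ) → 3 ≤ g → 2 ≤ k → k < g → 2 ≤ m →
    HasCard (GoodR g k) (m ∸ 1) →
    IsCompleteYoung g k m →
    (r₀ : ℕ) → GoodR g k r₀ → (∀ r → GoodR g k r → r₀ ≤ r) →
      ((∀ s r → YNode g k (pair s r) ⇔ (∃[ i ] (i < m × s ≡ i * r₀ × r ≡ i * r₀))) ×
       (∀ i → 1 ≤ i → i < m → ∀ c a →
          YEdge g k start c a (pair (i * r₀) (i * r₀)) ⇔ Label g k (i * r₀) c a) ×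
       (∀ i → i < m → ∀ c a →
          YEdge g k (pair 0 0) c a (pair (i * r₀) (i * r₀)) ⇔ Label g k (i * r₀) c a)) ×
      (RevCount g k 0 0 × RevCount g k 1 0 ×
       (∀ j → RevCount g k (2 * j + 2) ((m ∸ 1) * m ^ j) ×
              RevCount g k (2 * j + 3) ((m ∸ 1) * m ^ j))) ×
      (∀ c a → Label g k r₀ c a →
         ∀ N → RevMult g k N ⇔ (∃[ β ] (PalinDigits g m β × N ≡ (c * g + a) * β)))
theorem6 g k m 3≤g 2≤k k<g 2≤m goods young r₀ good₀ least =
  (young-nodes , start-edges , origin-edges) ,
  (count-zero , count 0 , λ j → count-even j , count-odd j) ,
  products
  where open Theorem6 g k m 3≤g 2≤k k<g 2≤m goods young r₀ good₀ least
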